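{- Let $k\geq 2$ and $n\geq 2k-3$. Then there exists a polynomial $P\in V_k$ such that $\varphi_k(P)\in W_k$ and such that, when $\varphi_k(P)$ is written as a linear combination of the polynomials $x_1\dotsm x_n \cdot (x_1^m+\dots+x_n^m)\cdot x_1^{2d_1}\dotsm x_n^{2d_n}$ (with non-negative integers $m,d_1,\dots,d_n$, $m+2(d_1+\dots+d_n)=2k-3$), the coefficient of $x_1\dotsm x_n \cdot (x_1^{2k-3}+\dots+x_n^{2k-3})$ is non-zero.
   Context: A polynomial has a zero of multiplicity at least $k$ at $a\in\mathbb{R}^n$ if all its partial derivatives of order at most $k-1$ vanish at $a$. A polynomial $P\in \mathbb{R}[x_1,\dots,x_n]$ is $k$-reduced if $\deg P\leq n+2k-3$ and no monomial of $P$ is divisible by $x_{i_1}^2\dotsm x_{i_k}^2$ for any (not necessarily distinct) $i_1,\dots,i_k\in \{1,\dots,n\}$. $V_k$ is the vector space of all $k$-reduced polynomials in $\mathbb{R}[x_1,\dots,x_n]$ having zeroes of multiplicity at least $k$ at all points of $\{0,1\}^n\setminus\{(0,\dots,0)\}$. $\varphi_k:V_k\to \mathbb{R}[x_1,\dots,x_n]$ is the linear map sending a polynomial to its homogeneous part of degree $n+2k-3$. $W_k$ is the subspace of $\mathbb{R}[x_1,\dots,x_n]$ spanned by all polynomials $x_1\dotsm x_n \cdot (x_1^m+\dots+x_n^m)\cdot x_1^{2d_1}\dotsm x_n^{2d_n}$ with non-negative integers $(m,d_1,\dots,d_n)$ satisfying $m+2(d_1+\dots+d_n)=2k-3$; for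 $n\geq k-1$ these polynomials are linearly independent, so the coefficients in such a linear combination are uniquely determined. -}

module Defs where

open import Data.Nat as ℕ using (ℕ; zero; suc; _∸_; _≤_; _<_)
open import Data.Integer using (+_)
open import Data.Rational as ℚ using (ℚ; 0ℚ; 1ℚ; _+_; _*_; _/_)
open import Data.Vec as Vec using (Vec; lookup; tabulate; updateAt; replicate)
import Data.Vec.Properties as VecP
open import Data.List as List using (List; []; _∷_; map; concatMap; filter; foldr; length)
open import Data.Product using (Σ; _×_; _,_; proj₁; proj₂)
open import Data.Bool using (Bool; true; false; if_then_else_)
open import Data.Fin as Fin using (Fin)
open import Relation.Nullary using (¬_; does)
open import Relation.Binary.PropositionalEquality using (_≡_; _≢_)

Mono : ℕ → Set
Mono n = Vec ℕ n

-- A polynomial in n variables with rational coefficients, as a finite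
-- formal sum of terms (coefficient , monomial); repeated monomials add up.
Poly : ℕ → Set
Poly n = List (ℚ × Mono n)

deg : ∀ {n} → Mono n → ℕ
deg = Vec.sum

ℕ→ℚ : ℕ → ℚ
ℕ→ℚ m = (+ m) / 1

coeff : ∀ {n} → Poly n → Mono n → ℚ
coeff [] e = 0ℚ
coeff ((c , f) ∷ P) e =
  if does (VecP.≡-dec ℕ._≟_ f e) then c + coeff P e else coeff P e

_^ℚ_ : ℚ → ℕ → ℚ
q ^ℚ zero = 1ℚ
q ^ℚ suc m = q * (q ^ℚ m)

evalMono : ∀ {n} → Mono n → Vec ℚ n → ℚ
evalMono e a = Vec.foldr (λ _ → ℚ) _*_ 1ℚ (Vec.zipWith _^ℚ_ a e)

eval : ∀ {n} → Poly n → Vec ℚ n → ℚ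
eval P a = foldr (λ t s → proj₁ t * evalMono (proj₂ t) a + s) 0ℚ P

∂ : ∀ {n} → Fin n → Poly n → Poly n
∂ i = map (λ t → (proj₁ t * ℕ→ℚ (lookup (proj₂ t) i)) , updateAt (proj₂ t) i (_∸ 1))

∂* : ∀ {n} → List (Fin n) → Poly n → Poly n
∂* is P = foldr ∂ P is

ZeroOfMult≥ : ∀ {n} → ℕ → Poly n → Vec ℚ n → Set
ZeroOfMult≥ k P a = ∀ is → length is < k → eval (∂* is P) a ≡ 0ℚ

_∣ₘ_ : ∀ {n} → Mono n → Mono n → Set
d ∣ₘ e = ∀ i → lookup d i ≤ lookup e i

sqMono : ∀ {n k} → Vec (Fin n) k → Mono n
sqMono {n} is = foldr (λ i e → updateAt e i (λ x → 2 ℕ.+ x)) (replicate n 0) (Vec.toList is)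

top : ℕ → ℕ → ℕ
top n k = n ℕ.+ 2 ℕ.* k ∸ 3

Reduced : ∀ {n} → ℕ → Poly n → Set
Reduced {n} k P =
  (∀ e → coeff P e ≢ 0ℚ → deg e ≤ top n k) ×
  (∀ e → coeff P e ≢ 0ℚ → (is : Vec (Fin n) k) → ¬ (sqMono is ∣ₘ e))

boolPt : ∀ {n} → Vec Bool n → Vec ℚ n
boolPt = Vec.map (λ b → if b then 1ℚ else 0ℚ)

InV : ∀ {n} → ℕ → Poly n → Set
InV {n} k P = Reduced k P ×
  ((a : Vec Bool n) → a ≢ replicate n false → ZeroOfMult≥ k P (boolPt a))

φ : ∀ {n} → ℕ → Poly n → Poly n
φ {n} k P = filter (λ t → deg (proj₂ t) ℕ.≟ top n k) P

scale : ∀ {n} → ℚ → Poly n → Poly n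
scale c = map (λ t → (c * proj₁ t) , proj₂ t)

-- x₁⋯xₙ · (x₁^m + ⋯ + xₙ^m) · x₁^{2d₁}⋯xₙ^{2dₙ}
basisW : ∀ {n} → ℕ → Mono n → Poly n
basisW {n} m d = map (λ i → 1ℚ , tabulate (λ j →
    1 ℕ.+ 2 ℕ.* lookup d j ℕ.+ (if does (j Fin.≟ i) then m else 0)))
  (List.allFin n)

-- a formal linear combination of the spanning polynomials of W_k:
-- entries (coefficient , m , (d₁,…,dₙ))
LinComb : ℕ → Set
LinComb n = List (ℚ × ℕ × Mono n)

WIndexed : ∀ {n} → ℕ → LinComb n → Set
WIndexed k [] = Data.Unit.⊤ where import Data.Unit
WIndexed k ((c , m , d) ∷ L) = (m ℕ.+ 2 ℕ.* deg d ≡ 2 ℕ.* k ∸ 3) × WIndexed k L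

combPoly : ∀ {n} → LinComb n → Poly n
combPoly = concatMap (λ t → scale (proj₁ t) (basisW (proj₁ (proj₂ t)) (proj₂ (proj₂ t))))

combCoeff : ∀ {n} → LinComb n → ℕ → Mono n → ℚ
combCoeff [] m d = 0ℚ
combCoeff ((c , m' , d') ∷ L) m d =
  if does (m' ℕ.≟ m) Data.Bool.∧ does (VecP.≡-dec ℕ._≟_ d' d)
  then c + combCoeff L m d else combCoeff L m d
  where import Data.Bool

{-# OPTIONS --safe #-}
module Submission where

-- Write b = k − 1. Let ρ₀(x) = 1 − x and ρⱼ(x) = cⱼ xʲ (x − 1)ʲ for j ≥ 1, where
-- cⱼ = (−1)ʲ⁻¹ Cat_{j−1} are the coefficients of the compositional inverse of y ↦ y + y²,
-- and take P = Σ_{j₁+⋯+jₙ ≤ b} ρ_{j₁}(x₁)⋯ρ_{jₙ}(xₙ).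
-- Since ρⱼ vanishes to order j at 0 and at 1, a derivative of order cᵢ in each xᵢ with
-- Σ cᵢ ≤ b, evaluated at a ∈ {0,1}ⁿ, is the product over i of Σ_{j ≤ cᵢ} ρⱼ^{(cᵢ)}(aᵢ).
-- The choice of cⱼ makes Σ_{j ≤ c} ρⱼ^{(c)}(1) = 0 (a hypergeometric identity, proved with
-- a Gosper certificate), so the product vanishes as soon as some aᵢ = 1.
-- The exponents of ρⱼ lie in [j, 2j] (in [0, 1] for j = 0), which makes P k-reduced, and
-- the monomials of P of degree n + 2b − 1 all come from a single jᵢ = b, so that
-- φ_k(P) = (−1)ⁿ⁻¹ c_b · x₁⋯xₙ (x₁^{2b−1} + ⋯ + xₙ^{2b−1}).

open import Level using (0ℓ)
open import Function using (_∘_; flip)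
open import Data.Bool using (Bool; true; false; if_then_else_)
open import Data.Empty using (⊥-elim)
open import Data.Unit using (tt)
open import Data.Product using (Σ; _×_; _,_; proj₁; proj₂)
open import Data.Sum using (inj₁; inj₂)
open import Data.Nat as ℕ using (ℕ; zero; suc; _*_; _∸_; _≤_; _<_; s≤s; z≤n; ⌊_/2⌋)
import Data.Nat.Properties as ℕP
import Data.Nat.Coprimality as Coprime
import Data.Integer as ℤ
open import Data.Rational as ℚ using (ℚ; 0ℚ; 1ℚ; _+_; _-_; -_; 1/_) renaming (_*_ to _·_)
import Data.Rational.Properties as ℚP
import Data.Rational.Unnormalised as ℚᵘ
import Data.Rational.Unnormalised.Properties as ℚᵘP
open import Data.List using (List; []; _∷_; map; _++_; length; concatMap; downFrom; filter)
import Data.List.Properties as ListP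
open import Data.List.Relation.Unary.All as All using (All; []; _∷_)
import Data.List.Relation.Unary.All.Properties as AllP
open import Data.Vec as Vec using (Vec; []; _∷_; lookup; updateAt; replicate)
import Data.Vec.Properties as VecP
open import Data.Fin as Fin using (Fin)
open import Relation.Nullary using (¬_; Dec; yes; no; does; contradiction)
open import Relation.Nullary.Decidable using (dec⇒maybe; dec-true; dec-false)
open import Relation.Unary using (Decidable)
open import Relation.Binary.Definitions using (tri<; tri≈; tri>)
open import Relation.Binary.PropositionalEquality
open import Algebra.Apartness.Properties.HeytingCommutativeRing ℚP.heytingCommutativeRing
  using (x#0y#0→xy#0)
open import Tactic.RingSolver using (solve-∀)
open import Tactic.RingSolver.Core.AlmostCommutativeRing using (AlmostCommutativeRing; fromCommutativeRing)
open import Data.Nat.Tactic.RingSolver renaming (solve-∀ to ℕ-solve-∀)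
open import Data.Integer.Tactic.RingSolver renaming (solve-∀ to ℤ-solve-∀)
open import Defs

open ≡-Reasoning

ℚ-ring : AlmostCommutativeRing 0ℓ 0ℓ
ℚ-ring = fromCommutativeRing ℚP.+-*-commutativeRing (λ x → dec⇒maybe (0ℚ ℚP.≟ x))

ℕ→ℚ-+ : ∀ m n → ℕ→ℚ (m ℕ.+ n) ≡ ℕ→ℚ m + ℕ→ℚ n
ℕ→ℚ-+ m n = ℚP.toℚᵘ-injective (begin-≃
  ℚ.toℚᵘ (ℕ→ℚ (m ℕ.+ n))                    ≈⟨ ℚP.toℚᵘ-fromℚᵘ (ℚᵘ.mkℚᵘ (ℤ.+ (m ℕ.+ n)) 0) ⟩
  ℚᵘ.mkℚᵘ (ℤ.+ m ℤ.+ ℤ.+ n) 0               ≈⟨ ℚᵘ.*≡* (cross (ℤ.+ m) (ℤ.+ n)) ⟩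
  ℚᵘ.mkℚᵘ (ℤ.+ m) 0 ℚᵘ.+ ℚᵘ.mkℚᵘ (ℤ.+ n) 0  ≈⟨ ℚᵘP.+-cong (ℚᵘP.≃-sym (ℚP.toℚᵘ-fromℚᵘ (ℚᵘ.mkℚᵘ (ℤ.+ m) 0)))
                                                            (ℚᵘP.≃-sym (ℚP.toℚᵘ-fromℚᵘ (ℚᵘ.mkℚᵘ (ℤ.+ n) 0))) ⟩
  ℚ.toℚᵘ (ℕ→ℚ m) ℚᵘ.+ ℚ.toℚᵘ (ℕ→ℚ n)       ≈⟨ ℚᵘP.≃-sym (ℚP.toℚᵘ-homo-+ (ℕ→ℚ m) (ℕ→ℚ n)) ⟩
  ℚ.toℚᵘ (ℕ→ℚ m + ℕ→ℚ n)                   ∎≃)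
  where
  open import Relation.Binary.Reasoning.Setoid ℚᵘP.≃-setoid
    renaming (begin_ to begin-≃_; _∎ to _∎≃)
  cross : ∀ a b → (a ℤ.+ b) ℤ.* (ℤ.1ℤ ℤ.* ℤ.1ℤ) ≡ (a ℤ.* ℤ.1ℤ ℤ.+ b ℤ.* ℤ.1ℤ) ℤ.* ℤ.1ℤ
  cross = ℤ-solve-∀

ℕ→ℚ-suc : ∀ m → ℕ→ℚ (suc m) ≡ ℕ→ℚ m + 1ℚ
ℕ→ℚ-suc m = trans (ℕ→ℚ-+ 1 m) (ℚP.+-comm 1ℚ (ℕ→ℚ m))

ℕ→ℚ-∸ : ∀ {m n} → n ≤ m → ℕ→ℚ (m ∸ n) ≡ ℕ→ℚ m - ℕ→ℚ n
ℕ→ℚ-∸ {m} {n} n≤m = begin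
  ℕ→ℚ (m ∸ n)                         ≡⟨ lemma (ℕ→ℚ (m ∸ n)) (ℕ→ℚ n) ⟩
  (ℕ→ℚ n + ℕ→ℚ (m ∸ n)) - ℕ→ℚ n      ≡⟨ cong (_- ℕ→ℚ n) (ℕ→ℚ-+ n (m ∸ n)) ⟨
  ℕ→ℚ (n ℕ.+ (m ∸ n)) - ℕ→ℚ n         ≡⟨ cong (λ k → ℕ→ℚ k - ℕ→ℚ n) (ℕP.m+[n∸m]≡n n≤m) ⟩
  ℕ→ℚ m - ℕ→ℚ n                       ∎
  where
  lemma : ∀ d n → d ≡ (n + d) - n
  lemma = solve-∀ ℚ-ring

ℕ→ℚ-suc≢0 : ∀ m → ℕ→ℚ (suc m) ≢ 0ℚ
ℕ→ℚ-suc≢0 m eq with trans (sym (ℚP.normalize-coprime (Coprime.sym (Coprime.1-coprimeTo (suc m))))) eq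
... | ()

neg≢0 : ∀ {p} → p ≢ 0ℚ → - p ≢ 0ℚ
neg≢0 p≢0 = p≢0 ∘ ℚP.neg-injective

1/≢0 : ∀ p .{{_ : ℚ.NonZero p}} → 1/ p ≢ 0ℚ
1/≢0 p eq = ℚP.1≢0 (begin
  1ℚ         ≡⟨ ℚP.*-inverseʳ p ⟨
  p · 1/ p   ≡⟨ cong (p ·_) eq ⟩
  p · 0ℚ     ≡⟨ ℚP.*-zeroʳ p ⟩
  0ℚ         ∎)

·-cancelˡ-≡ : ∀ p {x y} → p ≢ 0ℚ → p · x ≡ p · y → x ≡ y
·-cancelˡ-≡ p {x} {y} p≢0 px≡py = begin
  x               ≡⟨ cancel x ⟨
  p⁻¹ · (p · x)   ≡⟨ cong (p⁻¹ ·_) px≡py ⟩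
  p⁻¹ · (p · y)   ≡⟨ cancel y ⟩
  y               ∎
  where
  instance _ = ℚ.≢-nonZero p≢0
  p⁻¹ = 1/ p
  cancel : ∀ z → p⁻¹ · (p · z) ≡ z
  cancel z = trans (sym (ℚP.*-assoc p⁻¹ p z)) (trans (cong (_· z) (ℚP.*-inverseˡ p)) (ℚP.*-identityˡ z))

x≡0⇒x·y≡0 : ∀ {x} y → x ≡ 0ℚ → x · y ≡ 0ℚ
x≡0⇒x·y≡0 y refl = ℚP.*-zeroˡ y

y≡0⇒x·y≡0 : ∀ x {y} → y ≡ 0ℚ → x · y ≡ 0ℚ
y≡0⇒x·y≡0 x refl = ℚP.*-zeroʳ x

two : ℚ
two = 1ℚ + 1ℚ

two[two[1+n]-1]≡ℕ→ℚ : ∀ n → two · (two · ℕ→ℚ (suc n) - 1ℚ) ≡ ℕ→ℚ (suc (n ℕ.+ n) ℕ.+ suc (n ℕ.+ n))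
two[two[1+n]-1]≡ℕ→ℚ n = begin
  two · (two · ℕ→ℚ (suc n) - 1ℚ)                 ≡⟨ cong (λ x → two · (two · x - 1ℚ)) (ℕ→ℚ-suc n) ⟩
  two · (two · (N + 1ℚ) - 1ℚ)                     ≡⟨ lemma N ⟩
  ((N + N) + 1ℚ) + ((N + N) + 1ℚ)                 ≡⟨ cong (λ x → (x + 1ℚ) + (x + 1ℚ)) (ℕ→ℚ-+ n n) ⟨
  (ℕ→ℚ (n ℕ.+ n) + 1ℚ) + (ℕ→ℚ (n ℕ.+ n) + 1ℚ)     ≡⟨ cong (λ x → x + x) (ℕ→ℚ-suc (n ℕ.+ n)) ⟨
  ℕ→ℚ (suc (n ℕ.+ n)) + ℕ→ℚ (suc (n ℕ.+ n))       ≡⟨ ℕ→ℚ-+ (suc (n ℕ.+ n)) (suc (n ℕ.+ n)) ⟨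
  ℕ→ℚ (suc (n ℕ.+ n) ℕ.+ suc (n ℕ.+ n))           ∎
  where
  N = ℕ→ℚ n
  lemma : ∀ N → two · (two · (N + 1ℚ) - 1ℚ) ≡ ((N + N) + 1ℚ) + ((N + N) + 1ℚ)
  lemma = solve-∀ ℚ-ring

∑< : ℕ → (ℕ → ℚ) → ℚ
∑< zero    F = 0ℚ
∑< (suc m) F = F m + ∑< m F

∑<-cong : ∀ m {F G : ℕ → ℚ} → (∀ j → j < m → F j ≡ G j) → ∑< m F ≡ ∑< m G
∑<-cong zero    F≡G = refl
∑<-cong (suc m) F≡G = cong₂ _+_ (F≡G m ℕP.≤-refl) (∑<-cong m (λ j j<m → F≡G j (ℕP.m<n⇒m<1+n j<m)))

∑<-·ʳ : ∀ m F y → ∑< m (λ j → F j · y) ≡ ∑< m F · y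
∑<-·ʳ zero    F y = sym (ℚP.*-zeroˡ y)
∑<-·ʳ (suc m) F y = trans (cong ((F m · y) +_) (∑<-·ʳ m F y)) (sym (ℚP.*-distribʳ-+ y (F m) (∑< m F)))

∑<-shift : ∀ m F → ∑< (suc m) F ≡ F 0 + ∑< m (F ∘ suc)
∑<-shift zero    F = refl
∑<-shift (suc m) F = trans (cong (F (suc m) +_) (∑<-shift m F)) (swap (F (suc m)) (F 0) (∑< m (F ∘ suc)))
  where
  swap : ∀ a b c → a + (b + c) ≡ b + (a + c)
  swap = solve-∀ ℚ-ring

∑<-truncate : ∀ {c b} F → c ≤ b → (∀ j → c ≤ j → j < b → F j ≡ 0ℚ) → ∑< b F ≡ ∑< c F
∑<-truncate {c} {b} F c≤b F≡0 with ℕP.m≤n⇒m<n∨m≡n c≤b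
... | inj₂ refl = refl
∑<-truncate {c} {suc b} F c≤b F≡0 | inj₁ c<1+b = begin
  F b + ∑< b F   ≡⟨ cong₂ _+_ (F≡0 b (ℕP.≤-pred c<1+b) ℕP.≤-refl) (∑<-truncate F (ℕP.≤-pred c<1+b) F≡0′) ⟩
  0ℚ + ∑< c F    ≡⟨ ℚP.+-identityˡ (∑< c F) ⟩
  ∑< c F         ∎
  where
  F≡0′ : ∀ j → c ≤ j → j < b → F j ≡ 0ℚ
  F≡0′ j c≤j j<b = F≡0 j c≤j (ℕP.m<n⇒m<1+n j<b)

falling : ℕ → ℕ → ℚ
falling e zero    = 1ℚ
falling e (suc c) = falling e c · ℕ→ℚ (e ∸ c)

falling-< : ∀ {e c} → e < c → falling e c ≡ 0ℚ
falling-< {e} {suc c} (s≤s e≤c) with ℕP.m≤n⇒m<n∨m≡n e≤c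
... | inj₁ e<c  = x≡0⇒x·y≡0 (ℕ→ℚ (e ∸ c)) (falling-< e<c)
... | inj₂ refl = y≡0⇒x·y≡0 (falling e e) (cong ℕ→ℚ (ℕP.n∸n≡0 e))

falling-suc : ∀ e c → falling e (suc c) ≡ falling e c · (ℕ→ℚ e - ℕ→ℚ c)
falling-suc e c with c ℕ.≤? e
... | yes c≤e = cong (falling e c ·_) (ℕ→ℚ-∸ c≤e)
... | no  c≰e = trans (falling-< (ℕP.m<n⇒m<1+n (ℕP.≰⇒> c≰e)))
                      (sym (x≡0⇒x·y≡0 (ℕ→ℚ e - ℕ→ℚ c) (falling-< (ℕP.≰⇒> c≰e))))

falling-pred : ∀ e c → falling e (suc c) ≡ ℕ→ℚ e · falling (e ∸ 1) c
falling-pred e zero    = trans (ℚP.*-identityˡ (ℕ→ℚ e)) (sym (ℚP.*-identityʳ (ℕ→ℚ e)))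
falling-pred e (suc c) = begin
  falling e (suc c) · ℕ→ℚ (e ∸ suc c)               ≡⟨ cong (_· ℕ→ℚ (e ∸ suc c)) (falling-pred e c) ⟩
  ℕ→ℚ e · falling (e ∸ 1) c · ℕ→ℚ (e ∸ suc c)       ≡⟨ ℚP.*-assoc (ℕ→ℚ e) (falling (e ∸ 1) c) (ℕ→ℚ (e ∸ suc c)) ⟩
  ℕ→ℚ e · (falling (e ∸ 1) c · ℕ→ℚ (e ∸ suc c))     ≡⟨ cong (λ d → ℕ→ℚ e · (falling (e ∸ 1) c · ℕ→ℚ d)) (ℕP.∸-+-assoc e 1 c) ⟨
  ℕ→ℚ e · falling (e ∸ 1) (suc c)                   ∎

falling-pascal : ∀ e c → falling (suc e) (suc c) ≡ falling e (suc c) + ℕ→ℚ (suc c) · falling e c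
falling-pascal e c = begin
  falling (suc e) (suc c)                               ≡⟨ falling-pred (suc e) c ⟩
  ℕ→ℚ (suc e) · falling e c                             ≡⟨ cong (_· falling e c) (ℕ→ℚ-suc e) ⟩
  (ℕ→ℚ e + 1ℚ) · falling e c                            ≡⟨ lemma (falling e c) (ℕ→ℚ e) (ℕ→ℚ c) ⟩
  falling e c · (ℕ→ℚ e - ℕ→ℚ c) + (ℕ→ℚ c + 1ℚ) · falling e c
      ≡⟨ cong₂ _+_ (falling-suc e c) (cong (_· falling e c) (ℕ→ℚ-suc c)) ⟨
  falling e (suc c) + ℕ→ℚ (suc c) · falling e c         ∎
  where
  lemma : ∀ f e c → (e + 1ℚ) · f ≡ f · (e - c) + (c + 1ℚ) · f
  lemma = solve-∀ ℚ-ring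

UPoly : Set
UPoly = List (ℚ × ℕ)

evalU : UPoly → ℚ → ℚ
evalU []            x = 0ℚ
evalU ((k , e) ∷ g) x = k · x ^ℚ e + evalU g x

coeffU : UPoly → ℕ → ℚ
coeffU []            e₀ = 0ℚ
coeffU ((k , e) ∷ g) e₀ = if does (e ℕ.≟ e₀) then k + coeffU g e₀ else coeffU g e₀

coeffU-here : ∀ k e g → coeffU ((k , e) ∷ g) e ≡ k + coeffU g e
coeffU-here k e g rewrite dec-true (e ℕ.≟ e) refl = refl

coeffU-there : ∀ k e {e₀} g → e ≢ e₀ → coeffU ((k , e) ∷ g) e₀ ≡ coeffU g e₀
coeffU-there k e {e₀} g e≢e₀ rewrite dec-false (e ℕ.≟ e₀) e≢e₀ = refl

-- When c > e the exponent e ∸ c is junk, but then the coefficient falling e c is 0.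
∂ᵘ : ℕ → UPoly → UPoly
∂ᵘ c = map (λ (k , e) → k · falling e c , e ∸ c)

∂ᵘ-zero : ∀ g → ∂ᵘ 0 g ≡ g
∂ᵘ-zero []            = refl
∂ᵘ-zero ((k , e) ∷ g) = cong₂ _∷_ (cong (_, e) (ℚP.*-identityʳ k)) (∂ᵘ-zero g)

m∸n∸1≡m∸[1+n] : ∀ m n → m ∸ n ∸ 1 ≡ m ∸ suc n
m∸n∸1≡m∸[1+n] m n = trans (ℕP.∸-+-assoc m n 1) (cong (m ∸_) (ℕP.+-comm n 1))

∂ᵘ-∂ᵘ : ∀ c g → ∂ᵘ 1 (∂ᵘ c g) ≡ ∂ᵘ (suc c) g
∂ᵘ-∂ᵘ c []            = refl
∂ᵘ-∂ᵘ c ((k , e) ∷ g) = cong₂ _∷_ (cong₂ _,_ (lemma k (falling e c) (ℕ→ℚ (e ∸ c))) (m∸n∸1≡m∸[1+n] e c)) (∂ᵘ-∂ᵘ c g)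
  where
  lemma : ∀ k f d → k · f · (1ℚ · d) ≡ k · (f · d)
  lemma = solve-∀ ℚ-ring

mulX- : ℚ → UPoly → UPoly
mulX- a []            = []
mulX- a ((k , e) ∷ g) = (k , suc e) ∷ (- (a · k) , e) ∷ mulX- a g

mulX-^ : ℕ → ℚ → UPoly → UPoly
mulX-^ zero    a g = g
mulX-^ (suc i) a g = mulX- a (mulX-^ i a g)

falling·^-pull-x : ∀ e c x → falling e (suc c) · x ^ℚ (e ∸ c) ≡ x · (falling e (suc c) · x ^ℚ (e ∸ suc c))
falling·^-pull-x e c x with c ℕ.<? e
... | yes c<e = begin
  falling e (suc c) · x ^ℚ (e ∸ c)                ≡⟨ cong (λ d → falling e (suc c) · x ^ℚ d) (ℕP.+-∸-assoc 1 c<e) ⟩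
  falling e (suc c) · (x · x ^ℚ (e ∸ suc c))      ≡⟨ lemma (falling e (suc c)) x (x ^ℚ (e ∸ suc c)) ⟩
  x · (falling e (suc c) · x ^ℚ (e ∸ suc c))      ∎
  where
  lemma : ∀ f x y → f · (x · y) ≡ x · (f · y)
  lemma = solve-∀ ℚ-ring
... | no c≮e = trans (x≡0⇒x·y≡0 (x ^ℚ (e ∸ c)) f≡0) (sym (y≡0⇒x·y≡0 x (x≡0⇒x·y≡0 (x ^ℚ (e ∸ suc c)) f≡0)))
  where
  f≡0 = falling-< (s≤s (ℕP.≮⇒≥ c≮e))

falling·^-leibniz : ∀ e c x →
  falling (suc e) c · x ^ℚ (suc e ∸ c) ≡
  x · (falling e c · x ^ℚ (e ∸ c)) + ℕ→ℚ c · (falling e (c ∸ 1) · x ^ℚ (e ∸ (c ∸ 1)))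
falling·^-leibniz e zero    x = lemma x (x ^ℚ e) (1ℚ · x ^ℚ e)
  where
  lemma : ∀ x y z → 1ℚ · (x · y) ≡ x · (1ℚ · y) + 0ℚ · z
  lemma = solve-∀ ℚ-ring
falling·^-leibniz e (suc c) x = begin
  falling (suc e) (suc c) · x ^ℚ (e ∸ c)
    ≡⟨ cong (_· x ^ℚ (e ∸ c)) (falling-pascal e c) ⟩
  (falling e (suc c) + ℕ→ℚ (suc c) · falling e c) · x ^ℚ (e ∸ c)
    ≡⟨ ℚP.*-distribʳ-+ (x ^ℚ (e ∸ c)) (falling e (suc c)) (ℕ→ℚ (suc c) · falling e c) ⟩
  falling e (suc c) · x ^ℚ (e ∸ c) + ℕ→ℚ (suc c) · falling e c · x ^ℚ (e ∸ c)
    ≡⟨ cong₂ _+_ (falling·^-pull-x e c x) (ℚP.*-assoc (ℕ→ℚ (suc c)) (falling e c) (x ^ℚ (e ∸ c))) ⟩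
  x · (falling e (suc c) · x ^ℚ (e ∸ suc c)) + ℕ→ℚ (suc c) · (falling e c · x ^ℚ (e ∸ c)) ∎

evalU-∂ᵘ-mulX- : ∀ c a g x →
  evalU (∂ᵘ c (mulX- a g)) x ≡ (x - a) · evalU (∂ᵘ c g) x + ℕ→ℚ c · evalU (∂ᵘ (c ∸ 1) g) x
evalU-∂ᵘ-mulX- c a [] x = lemma (x - a) (ℕ→ℚ c)
  where
  lemma : ∀ u v → 0ℚ ≡ u · 0ℚ + v · 0ℚ
  lemma = solve-∀ ℚ-ring
evalU-∂ᵘ-mulX- c a ((k , e) ∷ g) x = begin
  k · falling (suc e) c · x ^ℚ (suc e ∸ c) + ((- (a · k)) · falling e c · x ^ℚ (e ∸ c) + evalU (∂ᵘ c (mulX- a g)) x)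
    ≡⟨ cong₂ (λ u v → u + ((- (a · k)) · falling e c · x ^ℚ (e ∸ c) + v))
         (trans (ℚP.*-assoc k _ _) (cong (k ·_) (falling·^-leibniz e c x))) (evalU-∂ᵘ-mulX- c a g x) ⟩
  k · (x · (F · X) + C · (F′ · X′)) + ((- (a · k)) · F · X + ((x - a) · R + C · R′))
    ≡⟨ lemma k x a F X C F′ X′ R R′ ⟩
  (x - a) · (k · F · X + R) + C · (k · F′ · X′ + R′) ∎
  where
  F = falling e c
  X = x ^ℚ (e ∸ c)
  F′ = falling e (c ∸ 1)
  X′ = x ^ℚ (e ∸ (c ∸ 1))
  C = ℕ→ℚ c
  R = evalU (∂ᵘ c g) x
  R′ = evalU (∂ᵘ (c ∸ 1) g) x
  lemma : ∀ k x a F X C F′ X′ R R′ →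
    k · (x · (F · X) + C · (F′ · X′)) + ((- (a · k)) · F · X + ((x - a) · R + C · R′))
    ≡ (x - a) · (k · F · X + R) + C · (k · F′ · X′ + R′)
  lemma = solve-∀ ℚ-ring

evalU-∂ᵘ-mulX-^ : ∀ i c a g → evalU (∂ᵘ c (mulX-^ i a g)) a ≡ falling c i · evalU (∂ᵘ (c ∸ i) g) a
evalU-∂ᵘ-mulX-^ zero    c a g = sym (ℚP.*-identityˡ (evalU (∂ᵘ c g) a))
evalU-∂ᵘ-mulX-^ (suc i) c a g = begin
  evalU (∂ᵘ c (mulX- a (mulX-^ i a g))) a
    ≡⟨ evalU-∂ᵘ-mulX- c a (mulX-^ i a g) a ⟩
  (a - a) · evalU (∂ᵘ c (mulX-^ i a g)) a + ℕ→ℚ c · evalU (∂ᵘ (c ∸ 1) (mulX-^ i a g)) a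
    ≡⟨ root a (evalU (∂ᵘ c (mulX-^ i a g)) a) _ ⟩
  ℕ→ℚ c · evalU (∂ᵘ (c ∸ 1) (mulX-^ i a g)) a
    ≡⟨ cong (ℕ→ℚ c ·_) (evalU-∂ᵘ-mulX-^ i (c ∸ 1) a g) ⟩
  ℕ→ℚ c · (falling (c ∸ 1) i · evalU (∂ᵘ (c ∸ 1 ∸ i) g) a)
    ≡⟨ sym (ℚP.*-assoc (ℕ→ℚ c) (falling (c ∸ 1) i) _) ⟩
  ℕ→ℚ c · falling (c ∸ 1) i · evalU (∂ᵘ (c ∸ 1 ∸ i) g) a
    ≡⟨ cong₂ (λ f d → f · evalU (∂ᵘ d g) a) (falling-pred c i) (sym (ℕP.∸-+-assoc c 1 i)) ⟨
  falling c (suc i) · evalU (∂ᵘ (c ∸ suc i) g) a ∎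
  where
  root : ∀ a u v → (a - a) · u + v ≡ v
  root = solve-∀ ℚ-ring

evalU-∂ᵘ-at-0 : ∀ c g → All (λ t → c < proj₂ t) g → evalU (∂ᵘ c g) 0ℚ ≡ 0ℚ
evalU-∂ᵘ-at-0 c []            []            = refl
evalU-∂ᵘ-at-0 c ((k , e) ∷ g) (c<e ∷ c<g) = begin
  k · falling e c · 0ℚ ^ℚ (e ∸ c) + evalU (∂ᵘ c g) 0ℚ
    ≡⟨ cong₂ (λ z r → k · falling e c · z + r) 0^e∸c≡0 (evalU-∂ᵘ-at-0 c g c<g) ⟩
  k · falling e c · 0ℚ + 0ℚ
    ≡⟨ trans (ℚP.+-identityʳ _) (ℚP.*-zeroʳ (k · falling e c)) ⟩
  0ℚ ∎
  where
  0^e∸c≡0 : 0ℚ ^ℚ (e ∸ c) ≡ 0ℚ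
  0^e∸c≡0 rewrite ℕP.+-∸-assoc 1 c<e = ℚP.*-zeroˡ (0ℚ ^ℚ (e ∸ suc c))

evalU-∂ᵘ-> : ∀ c g x → All (λ t → proj₂ t < c) g → evalU (∂ᵘ c g) x ≡ 0ℚ
evalU-∂ᵘ-> c []            x []            = refl
evalU-∂ᵘ-> c ((k , e) ∷ g) x (e<c ∷ g<c) = begin
  k · falling e c · x ^ℚ (e ∸ c) + evalU (∂ᵘ c g) x
    ≡⟨ cong₂ (λ f r → k · f · x ^ℚ (e ∸ c) + r) (falling-< e<c) (evalU-∂ᵘ-> c g x g<c) ⟩
  k · 0ℚ · x ^ℚ (e ∸ c) + 0ℚ
    ≡⟨ lemma k (x ^ℚ (e ∸ c)) ⟩
  0ℚ ∎
  where
  lemma : ∀ k y → k · 0ℚ · y + 0ℚ ≡ 0ℚ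
  lemma = solve-∀ ℚ-ring

All-mulX- : ∀ {P Q : ℕ → Set} a g → (∀ {e} → P e → Q (suc e) × Q e) →
  All (P ∘ proj₂) g → All (Q ∘ proj₂) (mulX- a g)
All-mulX- a []            step []         = []
All-mulX- a ((k , e) ∷ g) step (pe ∷ pg) = proj₁ (step pe) ∷ proj₂ (step pe) ∷ All-mulX- a g step pg

mulX-^-exponents-≥ : ∀ {l} i a g → All ((l ≤_) ∘ proj₂) g → All ((l ≤_) ∘ proj₂) (mulX-^ i a g)
mulX-^-exponents-≥ zero    a g l≤g = l≤g
mulX-^-exponents-≥ (suc i) a g l≤g =
  All-mulX- a (mulX-^ i a g) (λ l≤e → ℕP.m≤n⇒m≤1+n l≤e , l≤e) (mulX-^-exponents-≥ i a g l≤g)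

mulX-^-exponents-≤ : ∀ {u} i a g → All ((_≤ u) ∘ proj₂) g → All ((_≤ i ℕ.+ u) ∘ proj₂) (mulX-^ i a g)
mulX-^-exponents-≤ zero    a g g≤u = g≤u
mulX-^-exponents-≤ (suc i) a g g≤u =
  All-mulX- a (mulX-^ i a g) (λ e≤ → s≤s e≤ , ℕP.m≤n⇒m≤1+n e≤) (mulX-^-exponents-≤ i a g g≤u)

coeffU-> : ∀ {u e₀} g → All ((_≤ u) ∘ proj₂) g → u < e₀ → coeffU g e₀ ≡ 0ℚ
coeffU-> []            []          u<e₀ = refl
coeffU-> ((k , e) ∷ g) (e≤u ∷ g≤u) u<e₀ =
  trans (coeffU-there k e g (ℕP.<⇒≢ (ℕP.≤-<-trans e≤u u<e₀))) (coeffU-> g g≤u u<e₀)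

coeffU-mulX--top : ∀ {u} a g → All ((_≤ u) ∘ proj₂) g → coeffU (mulX- a g) (suc u) ≡ coeffU g u
coeffU-mulX--top a []            []          = refl
coeffU-mulX--top {u} a ((k , e) ∷ g) (e≤u ∷ g≤u) with e ℕ.≟ u
... | yes refl = begin
  coeffU ((k , suc e) ∷ (- (a · k) , e) ∷ mulX- a g) (suc e)  ≡⟨ coeffU-here k (suc e) ((- (a · k) , e) ∷ mulX- a g) ⟩
  k + coeffU ((- (a · k) , e) ∷ mulX- a g) (suc e)            ≡⟨ cong (k +_) (coeffU-there (- (a · k)) e (mulX- a g) (ℕP.<⇒≢ (ℕP.n<1+n e))) ⟩
  k + coeffU (mulX- a g) (suc e)                              ≡⟨ cong (k +_) (coeffU-mulX--top a g g≤u) ⟩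
  k + coeffU g e                                              ≡⟨ coeffU-here k e g ⟨
  coeffU ((k , e) ∷ g) e                                      ∎
... | no e≢u = begin
  coeffU ((k , suc e) ∷ (- (a · k) , e) ∷ mulX- a g) (suc u)  ≡⟨ coeffU-there k (suc e) ((- (a · k) , e) ∷ mulX- a g) (e≢u ∘ ℕP.suc-injective) ⟩
  coeffU ((- (a · k) , e) ∷ mulX- a g) (suc u)                ≡⟨ coeffU-there (- (a · k)) e (mulX- a g) (ℕP.<⇒≢ (s≤s e≤u)) ⟩
  coeffU (mulX- a g) (suc u)                                  ≡⟨ coeffU-mulX--top a g g≤u ⟩
  coeffU g u                                                  ≡⟨ coeffU-there k e g e≢u ⟨
  coeffU ((k , e) ∷ g) u                                      ∎

coeffU-mulX-^-top : ∀ {u} i a g → All ((_≤ u) ∘ proj₂) g → coeffU (mulX-^ i a g) (i ℕ.+ u) ≡ coeffU g u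
coeffU-mulX-^-top zero    a g g≤u = refl
coeffU-mulX-^-top (suc i) a g g≤u =
  trans (coeffU-mulX--top a (mulX-^ i a g) (mulX-^-exponents-≤ i a g g≤u)) (coeffU-mulX-^-top i a g g≤u)

1^≡1 : ∀ m → 1ℚ ^ℚ m ≡ 1ℚ
1^≡1 zero    = refl
1^≡1 (suc m) = trans (ℚP.*-identityˡ (1ℚ ^ℚ m)) (1^≡1 m)

-- The Catalan polynomials ρⱼ

signedCatalan : ℕ → ℚ
signedCatalan zero          = 0ℚ
signedCatalan (suc zero)    = 1ℚ
signedCatalan (suc (suc j)) =
  - (signedCatalan (suc j) · (two · (two · ℕ→ℚ (suc j) - 1ℚ))) · (1/ ℕ→ℚ (suc (suc j))) {{ℚ.≢-nonZero (ℕ→ℚ-suc≢0 (suc j))}}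

signedCatalan-rec : ∀ j →
  ℕ→ℚ (suc (suc j)) · signedCatalan (suc (suc j)) ≡ - (signedCatalan (suc j) · (two · (two · ℕ→ℚ (suc j) - 1ℚ)))
signedCatalan-rec j = begin
  N · (Y · N⁻¹)   ≡⟨ lemma N Y N⁻¹ ⟩
  Y · (N · N⁻¹)   ≡⟨ cong (Y ·_) (ℚP.*-inverseʳ N {{ℚ.≢-nonZero (ℕ→ℚ-suc≢0 (suc j))}}) ⟩
  Y · 1ℚ          ≡⟨ ℚP.*-identityʳ Y ⟩
  Y               ∎
  where
  N = ℕ→ℚ (suc (suc j))
  Y = - (signedCatalan (suc j) · (two · (two · ℕ→ℚ (suc j) - 1ℚ)))
  N⁻¹ = (1/ N) {{ℚ.≢-nonZero (ℕ→ℚ-suc≢0 (suc j))}}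
  lemma : ∀ a b c → a · (b · c) ≡ b · (a · c)
  lemma = solve-∀ ℚ-ring

signedCatalan≢0 : ∀ j → signedCatalan (suc j) ≢ 0ℚ
signedCatalan≢0 zero    = ℚP.1≢0
signedCatalan≢0 (suc j) =
  x#0y#0→xy#0 (neg≢0 (x#0y#0→xy#0 (signedCatalan≢0 j) two[two[1+j]-1]≢0))
              (1/≢0 (ℕ→ℚ (suc (suc j))) {{ℚ.≢-nonZero (ℕ→ℚ-suc≢0 (suc j))}})
  where
  two[two[1+j]-1]≢0 : two · (two · ℕ→ℚ (suc j) - 1ℚ) ≢ 0ℚ
  two[two[1+j]-1]≢0 eq = ℕ→ℚ-suc≢0 (j ℕ.+ j ℕ.+ suc (j ℕ.+ j)) (trans (sym (two[two[1+n]-1]≡ℕ→ℚ j)) eq)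

ρ : ℕ → UPoly
ρ zero    = (1ℚ , 0) ∷ (- 1ℚ , 1) ∷ []
ρ (suc j) = mulX-^ (suc j) 1ℚ ((signedCatalan (suc j) , suc j) ∷ [])

ρ-degree : ℕ → ℕ
ρ-degree zero    = 1
ρ-degree (suc j) = suc j ℕ.+ suc j

ρ-exponents-≤ : ∀ j → All ((_≤ ρ-degree j) ∘ proj₂) (ρ j)
ρ-exponents-≤ zero    = z≤n ∷ ℕP.≤-refl ∷ []
ρ-exponents-≤ (suc j) = mulX-^-exponents-≤ (suc j) 1ℚ _ (ℕP.≤-refl ∷ [])

ρ-exponents-≥ : ∀ j → All ((j ≤_) ∘ proj₂) (ρ j)
ρ-exponents-≥ zero    = z≤n ∷ z≤n ∷ []
ρ-exponents-≥ (suc j) = mulX-^-exponents-≥ (suc j) 1ℚ _ (ℕP.≤-refl ∷ [])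

ρ-top : ∀ j → coeffU (ρ (suc j)) (suc j ℕ.+ suc j) ≡ signedCatalan (suc j)
ρ-top j = trans (coeffU-mulX-^-top (suc j) 1ℚ _ (ℕP.≤-refl ∷ []))
                (trans (coeffU-here (signedCatalan (suc j)) (suc j) []) (ℚP.+-identityʳ _))

bit : Bool → ℚ
bit x = if x then 1ℚ else 0ℚ

∂ᵘρ-at-0 : ∀ {c j} → c < j → evalU (∂ᵘ c (ρ j)) 0ℚ ≡ 0ℚ
∂ᵘρ-at-0 {c} {j} c<j = evalU-∂ᵘ-at-0 c (ρ j) (All.map (ℕP.<-≤-trans c<j) (ρ-exponents-≥ j))

∂ᵘρ-at-1-> : ∀ {c j} → c < j → evalU (∂ᵘ c (ρ j)) 1ℚ ≡ 0ℚ
∂ᵘρ-at-1-> {c} {suc j} c<j =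
  trans (evalU-∂ᵘ-mulX-^ (suc j) c 1ℚ κxʲ) (x≡0⇒x·y≡0 (evalU (∂ᵘ (c ∸ suc j) κxʲ) 1ℚ) (falling-< c<j))
  where
  κxʲ = (signedCatalan (suc j) , suc j) ∷ []

∂ᵘρ-at-bit : ∀ {c j} x → c < j → evalU (∂ᵘ c (ρ j)) (bit x) ≡ 0ℚ
∂ᵘρ-at-bit true  = ∂ᵘρ-at-1->
∂ᵘρ-at-bit false = ∂ᵘρ-at-0

∑∂ᵘρ : ℕ → Bool → ℚ
∑∂ᵘρ c x = ∑< (suc c) (λ j → evalU (∂ᵘ c (ρ j)) (bit x))

catalanTerm : ℕ → ℕ → ℚ
catalanTerm c j = signedCatalan j · falling c j · falling j (c ∸ j)

∂ᵘρ-at-1 : ∀ c j → evalU (∂ᵘ c (ρ (suc j))) 1ℚ ≡ catalanTerm c (suc j)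
∂ᵘρ-at-1 c j = begin
  evalU (∂ᵘ c (ρ (suc j))) 1ℚ
    ≡⟨ evalU-∂ᵘ-mulX-^ (suc j) c 1ℚ _ ⟩
  falling c (suc j) · (κ · falling (suc j) (c ∸ suc j) · 1ℚ ^ℚ (suc j ∸ (c ∸ suc j)) + 0ℚ)
    ≡⟨ cong (λ y → falling c (suc j) · (κ · falling (suc j) (c ∸ suc j) · y + 0ℚ)) (1^≡1 (suc j ∸ (c ∸ suc j))) ⟩
  falling c (suc j) · (κ · falling (suc j) (c ∸ suc j) · 1ℚ + 0ℚ)
    ≡⟨ lemma (falling c (suc j)) κ (falling (suc j) (c ∸ suc j)) ⟩
  catalanTerm c (suc j) ∎
  where
  κ = signedCatalan (suc j)
  lemma : ∀ f κ g → f · (κ · g · 1ℚ + 0ℚ) ≡ κ · f · g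
  lemma = solve-∀ ℚ-ring

falling-ratio : ∀ j m →
  falling (suc j) m · (ℕ→ℚ (suc j) - ℕ→ℚ m) · (ℕ→ℚ j - ℕ→ℚ m) ≡ ℕ→ℚ (suc j) · falling j (suc m)
falling-ratio j m = begin
  falling (suc j) m · (ℕ→ℚ (suc j) - ℕ→ℚ m) · (ℕ→ℚ j - ℕ→ℚ m) ≡⟨ cong (_· (ℕ→ℚ j - ℕ→ℚ m)) (falling-suc (suc j) m) ⟨
  falling (suc j) (suc m) · (ℕ→ℚ j - ℕ→ℚ m)                    ≡⟨ cong (_· (ℕ→ℚ j - ℕ→ℚ m)) (falling-pred (suc j) m) ⟩
  ℕ→ℚ (suc j) · falling j m · (ℕ→ℚ j - ℕ→ℚ m)                  ≡⟨ ℚP.*-assoc (ℕ→ℚ (suc j)) (falling j m) _ ⟩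
  ℕ→ℚ (suc j) · (falling j m · (ℕ→ℚ j - ℕ→ℚ m))                ≡⟨ cong (ℕ→ℚ (suc j) ·_) (falling-suc j m) ⟨
  ℕ→ℚ (suc j) · falling j (suc m)                              ∎

-- The identity behind Gosper.ratio, with J = j + 1, N = j + 2, C = c, M = c − j − 2 and D = M + 1.
gosper-identity : ∀ J M C N D κ κ′ F G G′ → N ≢ 0ℚ →
  C ≡ J + 1ℚ + M → N ≡ J + 1ℚ → D ≡ M + 1ℚ →
  N · κ′ ≡ - (κ · (two · (two · J - 1ℚ))) → G′ · (N - M) · (J - M) ≡ N · G →
  (κ · F · G) · (two · (two · J - 1ℚ) · (C - J)) ≡
  (κ′ · (F · D) · G′) · (two · (two · N - 1ℚ) · (C - N) - C · (C - 1ℚ))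
gosper-identity J M C N D κ κ′ F G G′ N≢0 refl refl refl Nκ′≡ G′≡ = sym (·-cancelˡ-≡ N N≢0 (begin
  N · ((κ′ · (F · (M + 1ℚ)) · G′) · (two · (two · N - 1ℚ) · (C - N) - C · (C - 1ℚ)))
    ≡⟨ expand J M κ′ F G′ ⟩
  - ((N · κ′) · F · (M + 1ℚ) · (G′ · (N - M) · (J - M)))
    ≡⟨ cong₂ (λ u v → - (u · F · (M + 1ℚ) · v)) Nκ′≡ G′≡ ⟩
  - ((- (κ · (two · (two · J - 1ℚ)))) · F · (M + 1ℚ) · (N · G))
    ≡⟨ collect J M κ F G ⟩
  N · ((κ · F · G) · (two · (two · J - 1ℚ) · (C - J))) ∎))
  where
  expand : ∀ J M κ′ F G′ →
    (J + 1ℚ) · ((κ′ · (F · (M + 1ℚ)) · G′) · (two · (two · (J + 1ℚ) - 1ℚ) · ((J + 1ℚ + M) - (J + 1ℚ))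
      - (J + 1ℚ + M) · ((J + 1ℚ + M) - 1ℚ)))
    ≡ - (((J + 1ℚ) · κ′) · F · (M + 1ℚ) · (G′ · ((J + 1ℚ) - M) · (J - M)))
  expand = solve-∀ ℚ-ring
  collect : ∀ J M κ F G →
    - ((- (κ · (two · (two · J - 1ℚ)))) · F · (M + 1ℚ) · ((J + 1ℚ) · G))
    ≡ (J + 1ℚ) · ((κ · F · G) · (two · (two · J - 1ℚ) · ((J + 1ℚ + M) - J)))
  collect = solve-∀ ℚ-ring

-- K and Q come from Gosper's algorithm applied to j ↦ catalanTerm c j; as Q c = 0,
-- the certificate forces the full sum S c to vanish once K ≠ 0.
module Gosper (c : ℕ) where

  C K : ℚ
  C = ℕ→ℚ c
  K = C · (C - 1ℚ)

  Q : ℕ → ℚ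
  Q j = two · (two · ℕ→ℚ j - 1ℚ) · (C - ℕ→ℚ j)

  S : ℕ → ℚ
  S j = ∑< j (catalanTerm c ∘ suc)

  ratio : ∀ j → suc (suc j) ≤ c →
    catalanTerm c (suc j) · Q (suc j) ≡ catalanTerm c (suc (suc j)) · (Q (suc (suc j)) - K)
  ratio j 2+j≤c = begin
    catalanTerm c (suc j) · Q (suc j)
      ≡⟨ cong (λ d → signedCatalan (suc j) · falling c (suc j) · falling (suc j) d · Q (suc j)) c∸[1+j]≡1+m ⟩
    signedCatalan (suc j) · falling c (suc j) · falling (suc j) (suc m) · Q (suc j)
      ≡⟨ gosper-identity (ℕ→ℚ (suc j)) (ℕ→ℚ m) C (ℕ→ℚ (suc (suc j))) (ℕ→ℚ (c ∸ suc j))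
           (signedCatalan (suc j)) (signedCatalan (suc (suc j))) (falling c (suc j))
           (falling (suc j) (suc m)) (falling (suc (suc j)) m)
           (ℕ→ℚ-suc≢0 (suc j)) C≡ (ℕ→ℚ-suc (suc j)) D≡
           (signedCatalan-rec j) (falling-ratio (suc j) m) ⟩
    catalanTerm c (suc (suc j)) · (Q (suc (suc j)) - K) ∎
    where
    m = c ∸ suc (suc j)
    c∸[1+j]≡1+m : c ∸ suc j ≡ suc m
    c∸[1+j]≡1+m = ℕP.+-∸-assoc 1 2+j≤c
    D≡ : ℕ→ℚ (c ∸ suc j) ≡ ℕ→ℚ m + 1ℚ
    D≡ = trans (cong ℕ→ℚ c∸[1+j]≡1+m) (ℕ→ℚ-suc m)
    C≡ : C ≡ ℕ→ℚ (suc j) + 1ℚ + ℕ→ℚ m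
    C≡ = begin
      ℕ→ℚ c                                ≡⟨ cong ℕ→ℚ (ℕP.m+[n∸m]≡n 2+j≤c) ⟨
      ℕ→ℚ (suc (suc j) ℕ.+ m)              ≡⟨ ℕ→ℚ-+ (suc (suc j)) m ⟩
      ℕ→ℚ (suc (suc j)) + ℕ→ℚ m            ≡⟨ cong (_+ ℕ→ℚ m) (ℕ→ℚ-suc (suc j)) ⟩
      ℕ→ℚ (suc j) + 1ℚ + ℕ→ℚ m             ∎

  K≢0 : 2 ≤ c → K ≢ 0ℚ
  K≢0 (s≤s (s≤s {n = c′} _)) = x#0y#0→xy#0 (ℕ→ℚ-suc≢0 (suc c′)) C-1≢0
    where
    C-1≢0 : C - 1ℚ ≢ 0ℚ
    C-1≢0 eq = ℕ→ℚ-suc≢0 c′ (begin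
      ℕ→ℚ (suc c′)                ≡⟨ lemma (ℕ→ℚ (suc c′)) ⟩
      (ℕ→ℚ (suc c′) + 1ℚ) - 1ℚ    ≡⟨ cong (_- 1ℚ) (ℕ→ℚ-suc (suc c′)) ⟨
      C - 1ℚ                      ≡⟨ eq ⟩
      0ℚ                          ∎)
      where
      lemma : ∀ x → x ≡ (x + 1ℚ) - 1ℚ
      lemma = solve-∀ ℚ-ring

  certificate : 2 ≤ c → ∀ j → suc j ≤ c → K · S (suc j) ≡ catalanTerm c (suc j) · Q (suc j)
  certificate (s≤s (s≤s {n = zero} _)) zero _ = refl
  certificate (s≤s (s≤s {n = suc c′} _)) zero _ =
    trans (y≡0⇒x·y≡0 K (trans (ℚP.+-identityʳ _) T₁≡0)) (sym (x≡0⇒x·y≡0 (Q 1) T₁≡0))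
    where
    T₁≡0 : catalanTerm c 1 ≡ 0ℚ
    T₁≡0 = y≡0⇒x·y≡0 (signedCatalan 1 · falling c 1) (falling-< {1} {suc (suc c′)} (s≤s (s≤s z≤n)))
  certificate 2≤c (suc j) 2+j≤c = begin
    K · (T₂ + S (suc j))                ≡⟨ ℚP.*-distribˡ-+ K T₂ (S (suc j)) ⟩
    K · T₂ + K · S (suc j)              ≡⟨ cong (K · T₂ +_) (certificate 2≤c j (ℕP.<⇒≤ 2+j≤c)) ⟩
    K · T₂ + T₁ · Q (suc j)             ≡⟨ cong (K · T₂ +_) (ratio j 2+j≤c) ⟩
    K · T₂ + T₂ · (Q (suc (suc j)) - K) ≡⟨ lemma K T₂ (Q (suc (suc j))) ⟩
    T₂ · Q (suc (suc j))                ∎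
    where
    T₁ = catalanTerm c (suc j)
    T₂ = catalanTerm c (suc (suc j))
    lemma : ∀ K T Q → K · T + T · (Q - K) ≡ T · Q
    lemma = solve-∀ ℚ-ring

  S≡0 : 2 ≤ c → S c ≡ 0ℚ
  S≡0 2≤c@(s≤s {n = c-1} _) = ·-cancelˡ-≡ K (K≢0 2≤c) (begin
    K · S c                                   ≡⟨ certificate 2≤c c-1 ℕP.≤-refl ⟩
    catalanTerm c c · (two · (two · C - 1ℚ) · (C - C)) ≡⟨ lemma (catalanTerm c c) C ⟩
    K · 0ℚ                                    ∎)
    where
    lemma : ∀ T C → T · (two · (two · C - 1ℚ) · (C - C)) ≡ (C · (C - 1ℚ)) · 0ℚ
    lemma = solve-∀ ℚ-ring

∑∂ᵘρ-true : ∀ c → ∑∂ᵘρ c true ≡ 0ℚ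
∑∂ᵘρ-true zero            = refl
∑∂ᵘρ-true (suc zero)      = refl
∑∂ᵘρ-true c@(suc (suc _)) = begin
  ∑< (suc c) (λ j → evalU (∂ᵘ c (ρ j)) 1ℚ)
    ≡⟨ ∑<-shift c (λ j → evalU (∂ᵘ c (ρ j)) 1ℚ) ⟩
  evalU (∂ᵘ c (ρ 0)) 1ℚ + ∑< c (λ j → evalU (∂ᵘ c (ρ (suc j))) 1ℚ)
    ≡⟨ cong₂ _+_ (evalU-∂ᵘ-> c (ρ 0) 1ℚ (s≤s z≤n ∷ s≤s (s≤s z≤n) ∷ [])) (∑<-cong c (λ j _ → ∂ᵘρ-at-1 c j)) ⟩
  0ℚ + Gosper.S c c
    ≡⟨ cong (0ℚ +_) (Gosper.S≡0 c (s≤s (s≤s z≤n))) ⟩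
  0ℚ ∎

-- Products with a polynomial in the remaining variables

_⊙_ : ∀ {n} → ℚ × ℕ → Poly n → Poly (suc n)
(k , e) ⊙ A = map (λ (d , f) → k · d , e ∷ f) A

_⊗_ : ∀ {n} → UPoly → Poly n → Poly (suc n)
[]      ⊗ A = []
(t ∷ g) ⊗ A = t ⊙ A ++ g ⊗ A

∂-++ : ∀ {n} i (A B : Poly n) → ∂ i (A ++ B) ≡ ∂ i A ++ ∂ i B
∂-++ i = ListP.map-++ _

∂zero-⊗ : ∀ {n} g (A : Poly n) → ∂ Fin.zero (g ⊗ A) ≡ ∂ᵘ 1 g ⊗ A
∂zero-⊗ []            A = refl
∂zero-⊗ ((k , e) ∷ g) A = trans (∂-++ Fin.zero ((k , e) ⊙ A) (g ⊗ A)) (cong₂ _++_ (∂zero-⊙ A) (∂zero-⊗ g A))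
  where
  lemma : ∀ k d x → k · d · x ≡ k · (1ℚ · x) · d
  lemma = solve-∀ ℚ-ring
  ∂zero-⊙ : ∀ A → ∂ Fin.zero ((k , e) ⊙ A) ≡ (k · falling e 1 , e ∸ 1) ⊙ A
  ∂zero-⊙ []            = refl
  ∂zero-⊙ ((d , f) ∷ A) = cong₂ _∷_ (cong (_, _) (lemma k d (ℕ→ℚ e))) (∂zero-⊙ A)

∂suc-⊗ : ∀ {n} i g (A : Poly n) → ∂ (Fin.suc i) (g ⊗ A) ≡ g ⊗ ∂ i A
∂suc-⊗ i []            A = refl
∂suc-⊗ i ((k , e) ∷ g) A = trans (∂-++ (Fin.suc i) ((k , e) ⊙ A) (g ⊗ A)) (cong₂ _++_ (∂suc-⊙ A) (∂suc-⊗ i g A))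
  where
  ∂suc-⊙ : ∀ A → ∂ (Fin.suc i) ((k , e) ⊙ A) ≡ (k , e) ⊙ ∂ i A
  ∂suc-⊙ []            = refl
  ∂suc-⊙ ((d , f) ∷ A) = cong₂ _∷_ (cong (_, _) (ℚP.*-assoc k d (ℕ→ℚ (lookup f i)))) (∂suc-⊙ A)

zeroCount : ∀ {n} → List (Fin (suc n)) → ℕ
zeroCount []                = 0
zeroCount (Fin.zero  ∷ is) = suc (zeroCount is)
zeroCount (Fin.suc _ ∷ is) = zeroCount is

tailIndices : ∀ {n} → List (Fin (suc n)) → List (Fin n)
tailIndices []                = []
tailIndices (Fin.zero  ∷ is) = tailIndices is
tailIndices (Fin.suc i ∷ is) = i ∷ tailIndices is

length-zeroCount-tailIndices : ∀ {n} (is : List (Fin (suc n))) → length is ≡ zeroCount is ℕ.+ length (tailIndices is)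
length-zeroCount-tailIndices []                = refl
length-zeroCount-tailIndices (Fin.zero  ∷ is) = cong suc (length-zeroCount-tailIndices is)
length-zeroCount-tailIndices (Fin.suc i ∷ is) =
  trans (cong suc (length-zeroCount-tailIndices is)) (sym (ℕP.+-suc (zeroCount is) _))

∂*-⊗ : ∀ {n} is g (A : Poly n) → ∂* is (g ⊗ A) ≡ ∂ᵘ (zeroCount is) g ⊗ ∂* (tailIndices is) A
∂*-⊗ []                g A = cong (_⊗ A) (sym (∂ᵘ-zero g))
∂*-⊗ (Fin.zero  ∷ is) g A = begin
  ∂ Fin.zero (∂* is (g ⊗ A))                                     ≡⟨ cong (∂ Fin.zero) (∂*-⊗ is g A) ⟩
  ∂ Fin.zero (∂ᵘ (zeroCount is) g ⊗ ∂* (tailIndices is) A)       ≡⟨ ∂zero-⊗ (∂ᵘ (zeroCount is) g) _ ⟩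
  ∂ᵘ 1 (∂ᵘ (zeroCount is) g) ⊗ ∂* (tailIndices is) A             ≡⟨ cong (_⊗ _) (∂ᵘ-∂ᵘ (zeroCount is) g) ⟩
  ∂ᵘ (suc (zeroCount is)) g ⊗ ∂* (tailIndices is) A              ∎
∂*-⊗ (Fin.suc i ∷ is) g A = trans (cong (∂ (Fin.suc i)) (∂*-⊗ is g A)) (∂suc-⊗ i (∂ᵘ (zeroCount is) g) _)

eval-++ : ∀ {n} (A B : Poly n) a → eval (A ++ B) a ≡ eval A a + eval B a
eval-++ []      B a = sym (ℚP.+-identityˡ (eval B a))
eval-++ (t ∷ A) B a = trans (cong (proj₁ t · evalMono (proj₂ t) a +_) (eval-++ A B a))
                            (sym (ℚP.+-assoc (proj₁ t · evalMono (proj₂ t) a) (eval A a) (eval B a)))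

eval-⊗ : ∀ {n} g (A : Poly n) x a → eval (g ⊗ A) (x ∷ a) ≡ evalU g x · eval A a
eval-⊗ []            A x a = sym (ℚP.*-zeroˡ (eval A a))
eval-⊗ ((k , e) ∷ g) A x a = begin
  eval ((k , e) ⊙ A ++ g ⊗ A) (x ∷ a)               ≡⟨ eval-++ ((k , e) ⊙ A) (g ⊗ A) (x ∷ a) ⟩
  eval ((k , e) ⊙ A) (x ∷ a) + eval (g ⊗ A) (x ∷ a) ≡⟨ cong₂ _+_ (eval-⊙ A) (eval-⊗ g A x a) ⟩
  k · x ^ℚ e · eval A a + evalU g x · eval A a      ≡⟨ ℚP.*-distribʳ-+ (eval A a) (k · x ^ℚ e) (evalU g x) ⟨
  evalU ((k , e) ∷ g) x · eval A a                  ∎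
  where
  lemma : ∀ k d y m r → k · d · (y · m) + k · y · r ≡ k · y · (d · m + r)
  lemma = solve-∀ ℚ-ring
  eval-⊙ : ∀ A → eval ((k , e) ⊙ A) (x ∷ a) ≡ k · x ^ℚ e · eval A a
  eval-⊙ []            = sym (ℚP.*-zeroʳ (k · x ^ℚ e))
  eval-⊙ ((d , f) ∷ A) = trans (cong (k · d · (x ^ℚ e · evalMono f a) +_) (eval-⊙ A))
                               (lemma k d (x ^ℚ e) (evalMono f a) (eval A a))

coeff-++ : ∀ {n} (A B : Poly n) e → coeff (A ++ B) e ≡ coeff A e + coeff B e
coeff-++ []            B e = sym (ℚP.+-identityˡ (coeff B e))
coeff-++ ((d , f) ∷ A) B e with VecP.≡-dec ℕ._≟_ f e
... | yes _ = trans (cong (d +_) (coeff-++ A B e)) (sym (ℚP.+-assoc d (coeff A e) (coeff B e)))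
... | no  _ = coeff-++ A B e

coeff-⊙-here : ∀ {n} k e (A : Poly n) e′ → coeff ((k , e) ⊙ A) (e ∷ e′) ≡ k · coeff A e′
coeff-⊙-here k e []            e′ = sym (ℚP.*-zeroʳ k)
coeff-⊙-here k e ((d , f) ∷ A) e′ rewrite dec-true (e ℕ.≟ e) refl with VecP.≡-dec ℕ._≟_ f e′
... | yes _ = trans (cong (k · d +_) (coeff-⊙-here k e A e′)) (sym (ℚP.*-distribˡ-+ k d (coeff A e′)))
... | no  _ = coeff-⊙-here k e A e′

coeff-⊙-there : ∀ {n} k e e₀ (A : Poly n) e′ → e ≢ e₀ → coeff ((k , e) ⊙ A) (e₀ ∷ e′) ≡ 0ℚ
coeff-⊙-there k e e₀ []            e′ e≢e₀ = refl
coeff-⊙-there k e e₀ ((d , f) ∷ A) e′ e≢e₀ rewrite dec-false (e ℕ.≟ e₀) e≢e₀ = coeff-⊙-there k e e₀ A e′ e≢e₀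

coeff-⊗ : ∀ {n} g (A : Poly n) e₀ e′ → coeff (g ⊗ A) (e₀ ∷ e′) ≡ coeffU g e₀ · coeff A e′
coeff-⊗ []            A e₀ e′ = sym (ℚP.*-zeroˡ (coeff A e′))
coeff-⊗ ((k , e) ∷ g) A e₀ e′ = trans (coeff-++ ((k , e) ⊙ A) (g ⊗ A) (e₀ ∷ e′)) (split (e ℕ.≟ e₀))
  where
  split : Dec (e ≡ e₀) → coeff ((k , e) ⊙ A) (e₀ ∷ e′) + coeff (g ⊗ A) (e₀ ∷ e′) ≡ coeffU ((k , e) ∷ g) e₀ · coeff A e′
  split (yes refl) = begin
    coeff ((k , e) ⊙ A) (e ∷ e′) + coeff (g ⊗ A) (e ∷ e′) ≡⟨ cong₂ _+_ (coeff-⊙-here k e A e′) (coeff-⊗ g A e e′) ⟩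
    k · coeff A e′ + coeffU g e · coeff A e′             ≡⟨ ℚP.*-distribʳ-+ (coeff A e′) k (coeffU g e) ⟨
    (k + coeffU g e) · coeff A e′                        ≡⟨ cong (_· coeff A e′) (coeffU-here k e g) ⟨
    coeffU ((k , e) ∷ g) e · coeff A e′                  ∎
  split (no e≢e₀) = begin
    coeff ((k , e) ⊙ A) (e₀ ∷ e′) + coeff (g ⊗ A) (e₀ ∷ e′)
      ≡⟨ cong₂ _+_ (coeff-⊙-there k e e₀ A e′ e≢e₀) (coeff-⊗ g A e₀ e′) ⟩
    0ℚ + coeffU g e₀ · coeff A e′                           ≡⟨ ℚP.+-identityˡ _ ⟩
    coeffU g e₀ · coeff A e′                                ≡⟨ cong (_· coeff A e′) (coeffU-there k e g e≢e₀) ⟨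
    coeffU ((k , e) ∷ g) e₀ · coeff A e′                    ∎

∂*-++ : ∀ {n} is (A B : Poly n) → ∂* is (A ++ B) ≡ ∂* is A ++ ∂* is B
∂*-++ []       A B = refl
∂*-++ (i ∷ is) A B = trans (cong (∂ i) (∂*-++ is A B)) (∂-++ i (∂* is A) (∂* is B))

∂*-[] : ∀ {n} (is : List (Fin n)) → ∂* is [] ≡ []
∂*-[] []       = refl
∂*-[] (i ∷ is) = cong (∂ i) (∂*-[] is)

∂*-concatMap : ∀ {n} {X : Set} is (F : X → Poly n) xs → ∂* is (concatMap F xs) ≡ concatMap (∂* is ∘ F) xs
∂*-concatMap is F []       = ∂*-[] is
∂*-concatMap is F (x ∷ xs) = trans (∂*-++ is (F x) (concatMap F xs)) (cong (∂* is (F x) ++_) (∂*-concatMap is F xs))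

eval-concatMap-downFrom : ∀ {n} m (F : ℕ → Poly n) a → eval (concatMap F (downFrom m)) a ≡ ∑< m (λ j → eval (F j) a)
eval-concatMap-downFrom zero    F a = refl
eval-concatMap-downFrom (suc m) F a =
  trans (eval-++ (F m) (concatMap F (downFrom m)) a) (cong (eval (F m) a +_) (eval-concatMap-downFrom m F a))

coeff-concatMap-downFrom : ∀ {n} m (F : ℕ → Poly n) e → coeff (concatMap F (downFrom m)) e ≡ ∑< m (λ j → coeff (F j) e)
coeff-concatMap-downFrom zero    F e = refl
coeff-concatMap-downFrom (suc m) F e =
  trans (coeff-++ (F m) (concatMap F (downFrom m)) e) (cong (coeff (F m) e +_) (coeff-concatMap-downFrom m F e))

coeff≢0⇒ : ∀ {n} {Pr : Mono n → Set} (A : Poly n) e → All (Pr ∘ proj₂) A → coeff A e ≢ 0ℚ → Pr e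
coeff≢0⇒ []            e []         c≢0 = ⊥-elim (c≢0 refl)
coeff≢0⇒ ((d , f) ∷ A) e (pf ∷ pA) c≢0 with VecP.≡-dec ℕ._≟_ f e
... | yes refl = pf
... | no  _    = coeff≢0⇒ A e pA c≢0

coeff≡0 : ∀ {n} {Pr : Mono n → Set} (A : Poly n) e → All (Pr ∘ proj₂) A → ¬ Pr e → coeff A e ≡ 0ℚ
coeff≡0 A e pA ¬pe with coeff A e ℚP.≟ 0ℚ
... | yes c≡0 = c≡0
... | no  c≢0 = ⊥-elim (¬pe (coeff≢0⇒ A e pA c≢0))

All-⊙ : ∀ {n} {M : Mono n → Set} {R : Mono (suc n) → Set} k e (A : Poly n) →
  (∀ {f} → M f → R (e ∷ f)) → All (M ∘ proj₂) A → All (R ∘ proj₂) ((k , e) ⊙ A)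
All-⊙ k e []            M⇒R []        = []
All-⊙ k e ((d , f) ∷ A) M⇒R (Mf ∷ MA) = M⇒R Mf ∷ All-⊙ k e A M⇒R MA

All-⊗ : ∀ {n} {U : ℕ → Set} {M : Mono n → Set} {R : Mono (suc n) → Set} g (A : Poly n) →
  (∀ {e f} → U e → M f → R (e ∷ f)) → All (U ∘ proj₂) g → All (M ∘ proj₂) A → All (R ∘ proj₂) (g ⊗ A)
All-⊗ []            A UM⇒R []        MA = []
All-⊗ ((k , e) ∷ g) A UM⇒R (Ue ∷ Ug) MA = AllP.++⁺ (All-⊙ k e A (UM⇒R Ue) MA) (All-⊗ g A UM⇒R Ug MA)

All-concatMap-downFrom : ∀ {n} {R : Mono n → Set} m (F : ℕ → Poly n) →
  (∀ j → j < m → All (R ∘ proj₂) (F j)) → All (R ∘ proj₂) (concatMap F (downFrom m))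
All-concatMap-downFrom zero    F RF = []
All-concatMap-downFrom (suc m) F RF =
  AllP.++⁺ (RF m ℕP.≤-refl) (All-concatMap-downFrom m F (λ j j<m → RF j (ℕP.m<n⇒m<1+n j<m)))

coeff-filter : ∀ {n} {Q : Mono n → Set} (Q? : Decidable Q) A e → Q e → coeff (filter (Q? ∘ proj₂) A) e ≡ coeff A e
coeff-filter Q? []            e Qe = refl
coeff-filter Q? ((c , f) ∷ A) e Qe with Q? f
... | yes _ with VecP.≡-dec ℕ._≟_ f e
...   | yes _ = cong (c +_) (coeff-filter Q? A e Qe)
...   | no  _ = coeff-filter Q? A e Qe
coeff-filter Q? ((c , f) ∷ A) e Qe | no ¬Qf with VecP.≡-dec ℕ._≟_ f e
...   | yes refl = contradiction Qe ¬Qf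
...   | no  _    = coeff-filter Q? A e Qe

coeff-filter-¬ : ∀ {n} {Q : Mono n → Set} (Q? : Decidable Q) A e → ¬ Q e → coeff (filter (Q? ∘ proj₂) A) e ≡ 0ℚ
coeff-filter-¬ Q? []            e ¬Qe = refl
coeff-filter-¬ Q? ((c , f) ∷ A) e ¬Qe with Q? f
... | no _ = coeff-filter-¬ Q? A e ¬Qe
... | yes Qf with VecP.≡-dec ℕ._≟_ f e
...   | yes refl = contradiction Qf ¬Qe
...   | no  _    = coeff-filter-¬ Q? A e ¬Qe

coeff-scale : ∀ {n} c (A : Poly n) e → coeff (scale c A) e ≡ c · coeff A e
coeff-scale c []            e = sym (ℚP.*-zeroʳ c)
coeff-scale c ((d , f) ∷ A) e with VecP.≡-dec ℕ._≟_ f e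
... | yes _ = trans (cong (c · d +_) (coeff-scale c A e)) (sym (ℚP.*-distribˡ-+ c d (coeff A e)))
... | no  _ = coeff-scale c A e

-- The polynomial P and its zeroes

monomial : ∀ {n} → Mono n → Poly n
monomial f = (1ℚ , f) ∷ []

P : (n b : ℕ) → Poly n
P zero    b = monomial []
P (suc n) b = concatMap (λ j → ρ j ⊗ P n (b ∸ j)) (downFrom (suc b))

∏∑∂ᵘρ : ∀ {n} → List (Fin n) → Vec Bool n → ℚ
∏∑∂ᵘρ is       []      = 1ℚ
∏∑∂ᵘρ is       (x ∷ a) = ∑∂ᵘρ (zeroCount is) x · ∏∑∂ᵘρ (tailIndices is) a

eval-∂*-P : ∀ n b is (a : Vec Bool n) → length is ≤ b → eval (∂* is (P n b)) (boolPt a) ≡ ∏∑∂ᵘρ is a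
eval-∂*-P zero    b [] [] _ = ℚP.+-identityʳ (1ℚ · 1ℚ)
eval-∂*-P (suc n) b is (x ∷ a) |is|≤b = begin
  eval (∂* is (concatMap (λ j → ρ j ⊗ P n (b ∸ j)) (downFrom (suc b)))) (bit x ∷ boolPt a)
    ≡⟨ cong (λ A → eval A (bit x ∷ boolPt a)) (∂*-concatMap is (λ j → ρ j ⊗ P n (b ∸ j)) (downFrom (suc b))) ⟩
  eval (concatMap (λ j → ∂* is (ρ j ⊗ P n (b ∸ j))) (downFrom (suc b))) (bit x ∷ boolPt a)
    ≡⟨ eval-concatMap-downFrom (suc b) (λ j → ∂* is (ρ j ⊗ P n (b ∸ j))) (bit x ∷ boolPt a) ⟩
  ∑< (suc b) (λ j → eval (∂* is (ρ j ⊗ P n (b ∸ j))) (bit x ∷ boolPt a))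
    ≡⟨ ∑<-cong (suc b) (λ j _ → split j) ⟩
  ∑< (suc b) term
    ≡⟨ ∑<-truncate term (s≤s c≤b) (λ j c<j _ → high j c<j) ⟩
  ∑< (suc c) term
    ≡⟨ ∑<-cong (suc c) (λ j j≤c → cong (evalU (∂ᵘ c (ρ j)) (bit x) ·_) (low j (ℕP.≤-pred j≤c))) ⟩
  ∑< (suc c) (λ j → evalU (∂ᵘ c (ρ j)) (bit x) · ∏∑∂ᵘρ (tailIndices is) a)
    ≡⟨ ∑<-·ʳ (suc c) (λ j → evalU (∂ᵘ c (ρ j)) (bit x)) (∏∑∂ᵘρ (tailIndices is) a) ⟩
  ∑∂ᵘρ c x · ∏∑∂ᵘρ (tailIndices is) a ∎
  where
  c = zeroCount is
  l = length (tailIndices is)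
  c+l≤b : c ℕ.+ l ≤ b
  c+l≤b = subst (_≤ b) (length-zeroCount-tailIndices is) |is|≤b
  c≤b : c ≤ b
  c≤b = ℕP.m+n≤o⇒m≤o c c+l≤b
  term : ℕ → ℚ
  term j = evalU (∂ᵘ c (ρ j)) (bit x) · eval (∂* (tailIndices is) (P n (b ∸ j))) (boolPt a)
  split : ∀ j → eval (∂* is (ρ j ⊗ P n (b ∸ j))) (bit x ∷ boolPt a) ≡ term j
  split j = trans (cong (λ A → eval A (bit x ∷ boolPt a)) (∂*-⊗ is (ρ j) (P n (b ∸ j))))
                  (eval-⊗ (∂ᵘ c (ρ j)) (∂* (tailIndices is) (P n (b ∸ j))) (bit x) (boolPt a))
  high : ∀ j → c < j → term j ≡ 0ℚ
  high j c<j = x≡0⇒x·y≡0 (eval (∂* (tailIndices is) (P n (b ∸ j))) (boolPt a)) (∂ᵘρ-at-bit x c<j)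
  low : ∀ j → j ≤ c → eval (∂* (tailIndices is) (P n (b ∸ j))) (boolPt a) ≡ ∏∑∂ᵘρ (tailIndices is) a
  low j j≤c = eval-∂*-P n (b ∸ j) (tailIndices is) a
    (ℕP.≤-trans (ℕP.m+n≤o⇒m≤o∸n l (subst (_≤ b) (ℕP.+-comm c l) c+l≤b)) (ℕP.∸-monoʳ-≤ b j≤c))

∏∑∂ᵘρ≡0 : ∀ {n} is (a : Vec Bool n) → a ≢ replicate n false → ∏∑∂ᵘρ is a ≡ 0ℚ
∏∑∂ᵘρ≡0 is []         a≢0 = ⊥-elim (a≢0 refl)
∏∑∂ᵘρ≡0 is (true ∷ a) _   = x≡0⇒x·y≡0 (∏∑∂ᵘρ (tailIndices is) a) (∑∂ᵘρ-true (zeroCount is))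
∏∑∂ᵘρ≡0 is (false ∷ a) a≢0 =
  y≡0⇒x·y≡0 (∑∂ᵘρ (zeroCount is) false) (∏∑∂ᵘρ≡0 (tailIndices is) a (a≢0 ∘ cong (false ∷_)))

P-zeroOfMult : ∀ n b (a : Vec Bool n) → a ≢ replicate n false → ZeroOfMult≥ (suc b) (P n b) (boolPt a)
P-zeroOfMult n b a a≢0 is (s≤s |is|≤b) = trans (eval-∂*-P n b is a |is|≤b) (∏∑∂ᵘρ≡0 is a a≢0)

-- Reducedness

sqDegree : ∀ {n} → Mono n → ℕ
sqDegree e = Vec.sum (Vec.map ⌊_/2⌋ e)

sqDegree-mono : ∀ {n} (d e : Mono n) → d ∣ₘ e → sqDegree d ≤ sqDegree e
sqDegree-mono []      []      d∣e = z≤n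
sqDegree-mono (x ∷ d) (y ∷ e) d∣e =
  ℕP.+-mono-≤ (ℕP.⌊n/2⌋-mono (d∣e Fin.zero)) (sqDegree-mono d e (d∣e ∘ Fin.suc))

sqDegree-sqMono : ∀ {n k} (is : Vec (Fin n) k) → sqDegree (sqMono is) ≡ k
sqDegree-sqMono {n} []       = replicate-0 n
  where
  replicate-0 : ∀ n → sqDegree (replicate n 0) ≡ 0
  replicate-0 zero    = refl
  replicate-0 (suc n) = replicate-0 n
sqDegree-sqMono (i ∷ is) = trans (add-square (sqMono is) i) (cong suc (sqDegree-sqMono is))
  where
  add-square : ∀ {n} (e : Mono n) i → sqDegree (updateAt e i (2 ℕ.+_)) ≡ suc (sqDegree e)
  add-square (x ∷ e) Fin.zero    = refl
  add-square (x ∷ e) (Fin.suc i) = trans (cong (⌊ x /2⌋ ℕ.+_) (add-square e i)) (ℕP.+-suc ⌊ x /2⌋ (sqDegree e))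

degBound : ℕ → ℕ → ℕ
degBound n zero    = n
degBound n (suc b) = n ℕ.+ (b ℕ.+ suc b)

degBound-suc : ∀ n b → degBound (suc n) b ≡ suc (degBound n b)
degBound-suc n zero    = refl
degBound-suc n (suc b) = refl

degBound≤ : ∀ n b → degBound n b ≤ n ℕ.+ (b ℕ.+ b)
degBound≤ n zero    = ℕP.≤-reflexive (sym (ℕP.+-identityʳ n))
degBound≤ n (suc b) = ℕP.+-monoʳ-≤ n (ℕP.m≤n⇒m≤1+n ℕP.≤-refl)

Bounded : ∀ n → ℕ → Mono n → Set
Bounded n b f = sqDegree f ≤ b × deg f ≤ degBound n b

Bounded-∷ : ∀ {n b j e} {f : Mono n} → j ≤ b → e ≤ ρ-degree j → Bounded n (b ∸ j) f → Bounded (suc n) b (e ∷ f)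
Bounded-∷ {n} {b} {zero} {e} {f} _ e≤1 (sq≤b , deg≤) =
  ℕP.+-mono-≤ (ℕP.⌊n/2⌋-mono e≤1) sq≤b , subst (e ℕ.+ deg f ≤_) (sym (degBound-suc n b)) (ℕP.+-mono-≤ e≤1 deg≤)
Bounded-∷ {n} {b = suc b′} {suc j} {e} {f} j<b e≤2j (sq≤r , deg≤) = sq≤b , deg≤b
  where
  r = suc b′ ∸ suc j
  b≡ : suc j ℕ.+ r ≡ suc b′
  b≡ = ℕP.m+[n∸m]≡n j<b
  sq≤b : ⌊ e /2⌋ ℕ.+ sqDegree f ≤ suc b′
  sq≤b = subst (⌊ e /2⌋ ℕ.+ sqDegree f ≤_) b≡
           (ℕP.+-mono-≤ (subst (⌊ e /2⌋ ≤_) (sym (ℕP.n≡⌊n+n/2⌋ (suc j))) (ℕP.⌊n/2⌋-mono e≤2j)) sq≤r)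
  deg≤b : e ℕ.+ deg f ≤ suc n ℕ.+ (b′ ℕ.+ suc b′)
  deg≤b = ℕP.≤-trans (ℕP.+-mono-≤ e≤2j (ℕP.≤-trans deg≤ (degBound≤ n r))) (ℕP.≤-reflexive (begin
    (suc j ℕ.+ suc j) ℕ.+ (n ℕ.+ (r ℕ.+ r))          ≡⟨ lemma (suc j) n r ⟩
    n ℕ.+ ((suc j ℕ.+ r) ℕ.+ (suc j ℕ.+ r))          ≡⟨ cong (λ x → n ℕ.+ (x ℕ.+ x)) b≡ ⟩
    n ℕ.+ (suc b′ ℕ.+ suc b′)                        ≡⟨ ℕP.+-suc n (b′ ℕ.+ suc b′) ⟩
    suc n ℕ.+ (b′ ℕ.+ suc b′)                        ∎))
    where
    lemma : ∀ j n r → (j ℕ.+ j) ℕ.+ (n ℕ.+ (r ℕ.+ r)) ≡ n ℕ.+ ((j ℕ.+ r) ℕ.+ (j ℕ.+ r))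
    lemma = ℕ-solve-∀

P-bounded : ∀ n b → All (Bounded n b ∘ proj₂) (P n b)
P-bounded zero    b = (z≤n , z≤n) ∷ []
P-bounded (suc n) b = All-concatMap-downFrom (suc b) (λ j → ρ j ⊗ P n (b ∸ j))
  (λ j j≤b → All-⊗ (ρ j) (P n (b ∸ j)) (λ {e} {f} → Bounded-∷ {f = f} (ℕP.≤-pred j≤b)) (ρ-exponents-≤ j) (P-bounded n (b ∸ j)))

top≡degBound : ∀ n b → top n (suc (suc b)) ≡ degBound n (suc b)
top≡degBound n b = cong (_∸ 3) (lemma n b)
  where
  lemma : ∀ n b → n ℕ.+ 2 ℕ.* suc (suc b) ≡ 3 ℕ.+ (n ℕ.+ (b ℕ.+ suc b))
  lemma = ℕ-solve-∀

P-reduced : ∀ n b → Reduced (suc (suc b)) (P n (suc b))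
P-reduced n b = deg≤top , no-square-divisor
  where
  deg≤top : ∀ e → coeff (P n (suc b)) e ≢ 0ℚ → deg e ≤ top n (suc (suc b))
  deg≤top e c≢0 = subst (deg e ≤_) (sym (top≡degBound n b)) (proj₂ (coeff≢0⇒ (P n (suc b)) e (P-bounded n (suc b)) c≢0))
  no-square-divisor : ∀ e → coeff (P n (suc b)) e ≢ 0ℚ → (is : Vec (Fin n) (suc (suc b))) → ¬ (sqMono is ∣ₘ e)
  no-square-divisor e c≢0 is sq∣e = ℕP.n≮n (suc b) (ℕP.≤-trans
    (subst (_≤ sqDegree e) (sqDegree-sqMono is) (sqDegree-mono (sqMono is) e sq∣e))
    (proj₁ (coeff≢0⇒ (P n (suc b)) e (P-bounded n (suc b)) c≢0)))

-- The top-degree part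

ones : ∀ n → Mono n
ones n = replicate n 1

x₁⋯xₙ : ∀ n → Poly n
x₁⋯xₙ n = monomial (ones n)

deg-ones : ∀ n → deg (ones n) ≡ n
deg-ones zero    = refl
deg-ones (suc n) = cong suc (deg-ones n)

basisW₀ : ∀ n → ℕ → Poly n
basisW₀ n m = basisW m (replicate n 0)

basisW₀-suc : ∀ n m → basisW₀ (suc n) m ≡ (1ℚ , suc m) ⊙ x₁⋯xₙ n ++ (1ℚ , 1) ⊙ basisW₀ n m
basisW₀-suc n m = cong₂ _∷_ (cong (λ v → 1ℚ , suc m ∷ v) (tabulate-ones n))
  (trans (ListP.map-tabulate Fin.suc _) (sym (trans (cong ((1ℚ , 1) ⊙_) (ListP.map-tabulate (λ i → i) _))
                                                     (ListP.map-tabulate _ _))))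
  where
  tabulate-ones : ∀ n → Vec.tabulate (λ j → 1 ℕ.+ 2 ℕ.* lookup (replicate n 0) j ℕ.+ 0) ≡ ones n
  tabulate-ones zero    = refl
  tabulate-ones (suc n) = cong (1 ∷_) (tabulate-ones n)

basisW₀-homogeneous : ∀ n m → All ((λ f → deg f ≡ n ℕ.+ m) ∘ proj₂) (basisW₀ n m)
basisW₀-homogeneous zero    m = []
basisW₀-homogeneous (suc n) m = subst (All ((λ f → deg f ≡ suc n ℕ.+ m) ∘ proj₂)) (sym (basisW₀-suc n m))
  (AllP.++⁺ (cong suc (trans (cong (m ℕ.+_) (deg-ones n)) (ℕP.+-comm m n)) ∷ [])
            (All-⊙ 1ℚ 1 (basisW₀ n m) (cong suc) (basisW₀-homogeneous n m)))

coeff-P-suc : ∀ n b e₀ e′ → coeff (P (suc n) b) (e₀ ∷ e′) ≡ ∑< (suc b) (λ j → coeffU (ρ j) e₀ · coeff (P n (b ∸ j)) e′)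
coeff-P-suc n b e₀ e′ = trans (coeff-concatMap-downFrom (suc b) (λ j → ρ j ⊗ P n (b ∸ j)) (e₀ ∷ e′))
                              (∑<-cong (suc b) (λ j _ → coeff-⊗ (ρ j) (P n (b ∸ j)) e₀ e′))

coeff-P-> : ∀ n b e → degBound n b < deg e → coeff (P n b) e ≡ 0ℚ
coeff-P-> n b e d<e = coeff≡0 (P n b) e (P-bounded n b) (λ bd → ℕP.<-irrefl refl (ℕP.<-≤-trans d<e (proj₂ bd)))

P₀-top : ∀ n e → n ≤ deg e → coeff (P n 0) e ≡ (- 1ℚ) ^ℚ n · coeff (x₁⋯xₙ n) e
P₀-top zero    []         _   = refl
P₀-top (suc n) (e₀ ∷ e′) n<e =
  trans (coeff-P-suc n 0 e₀ e′) (trans (ℚP.+-identityʳ _) (by-exponent e₀ n<e))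
  where
  by-exponent : ∀ e₀ → suc n ≤ e₀ ℕ.+ deg e′ →
    coeffU (ρ 0) e₀ · coeff (P n 0) e′ ≡ (- 1ℚ) ^ℚ suc n · coeff ((1ℚ , 1) ⊙ x₁⋯xₙ n) (e₀ ∷ e′)
  by-exponent zero n<e′ =
    trans (y≡0⇒x·y≡0 (coeffU (ρ 0) 0) (coeff-P-> n 0 e′ n<e′))
          (sym (y≡0⇒x·y≡0 ((- 1ℚ) ^ℚ suc n) (coeff-⊙-there 1ℚ 1 0 (x₁⋯xₙ n) e′ λ ())))
  by-exponent (suc zero) (s≤s n≤e′) = begin
    (- 1ℚ + 0ℚ) · coeff (P n 0) e′                      ≡⟨ cong ((- 1ℚ + 0ℚ) ·_) (P₀-top n e′ n≤e′) ⟩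
    (- 1ℚ + 0ℚ) · ((- 1ℚ) ^ℚ n · coeff (x₁⋯xₙ n) e′)    ≡⟨ lemma ((- 1ℚ) ^ℚ n) (coeff (x₁⋯xₙ n) e′) ⟩
    (- 1ℚ) ^ℚ suc n · (1ℚ · coeff (x₁⋯xₙ n) e′)         ≡⟨ cong ((- 1ℚ) ^ℚ suc n ·_) (coeff-⊙-here 1ℚ 1 (x₁⋯xₙ n) e′) ⟨
    (- 1ℚ) ^ℚ suc n · coeff ((1ℚ , 1) ⊙ x₁⋯xₙ n) (1 ∷ e′) ∎
    where
    lemma : ∀ s c → (- 1ℚ + 0ℚ) · (s · c) ≡ (- 1ℚ · s) · (1ℚ · c)
    lemma = solve-∀ ℚ-ring
  by-exponent (suc (suc e₀)) _ =
    trans (ℚP.*-zeroˡ (coeff (P n 0) e′))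
          (sym (y≡0⇒x·y≡0 ((- 1ℚ) ^ℚ suc n) (coeff-⊙-there 1ℚ 1 (suc (suc e₀)) (x₁⋯xₙ n) e′ λ ())))

coeff-basisW₀-suc : ∀ n m e₀ e′ →
  coeff (basisW₀ (suc n) m) (e₀ ∷ e′) ≡
  coeff ((1ℚ , suc m) ⊙ x₁⋯xₙ n) (e₀ ∷ e′) + coeff ((1ℚ , 1) ⊙ basisW₀ n m) (e₀ ∷ e′)
coeff-basisW₀-suc n m e₀ e′ = trans (cong (λ A → coeff A (e₀ ∷ e′)) (basisW₀-suc n m))
                               (coeff-++ ((1ℚ , suc m) ⊙ x₁⋯xₙ n) ((1ℚ , 1) ⊙ basisW₀ n m) (e₀ ∷ e′))

module TopDegree (b : ℕ) where

  m : ℕ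
  m = b ℕ.+ suc b

  κ : ℕ → ℚ
  κ n = - (signedCatalan (suc b) · (- 1ℚ) ^ℚ n)

  κ≢0 : ∀ n → κ n ≢ 0ℚ
  κ≢0 n = neg≢0 (x#0y#0→xy#0 (signedCatalan≢0 b) (±1≢0 n))
    where
    ±1≢0 : ∀ n → (- 1ℚ) ^ℚ n ≢ 0ℚ
    ±1≢0 zero    = ℚP.1≢0
    ±1≢0 (suc n) = x#0y#0→xy#0 (neg≢0 ℚP.1≢0) (±1≢0 n)

  summand : ∀ n → ℕ → Mono n → ℕ → ℚ
  summand n e₀ e′ j = coeffU (ρ j) e₀ · coeff (P n (suc b ∸ j)) e′

  middle-degBound< : ∀ n {j e₀ d} → suc j ≤ b → e₀ ≤ suc j ℕ.+ suc j → suc n ℕ.+ m ≤ e₀ ℕ.+ d →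
    degBound n (suc b ∸ suc j) < d
  middle-degBound< n {j} {e₀} {d} j<b e₀≤ m≤ = subst (λ x → degBound n x < d) (sym (ℕP.+-∸-assoc 1 j<b))
    (ℕP.+-cancelˡ-≤ (suc j ℕ.+ suc j) _ _
      (ℕP.≤-trans (ℕP.≤-reflexive (trans (lemma j n r) (cong (λ x → suc n ℕ.+ (x ℕ.+ suc x)) (ℕP.m+[n∸m]≡n j<b))))
                  (ℕP.≤-trans m≤ (ℕP.+-monoˡ-≤ d e₀≤))))
    where
    r = b ∸ suc j
    lemma : ∀ j n r → (suc j ℕ.+ suc j) ℕ.+ suc (n ℕ.+ (r ℕ.+ suc r)) ≡ suc n ℕ.+ ((suc j ℕ.+ r) ℕ.+ suc (suc j ℕ.+ r))
    lemma = ℕ-solve-∀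

  summand-middle : ∀ n e₀ e′ → suc n ℕ.+ m ≤ e₀ ℕ.+ deg e′ → ∀ j → 1 ≤ j → j < suc b → summand n e₀ e′ j ≡ 0ℚ
  summand-middle n e₀ e′ m≤e (suc j) _ (s≤s j<b) with e₀ ℕ.≤? ρ-degree (suc j)
  ... | yes e₀≤ = y≡0⇒x·y≡0 (coeffU (ρ (suc j)) e₀) (coeff-P-> n (suc b ∸ suc j) e′ (middle-degBound< n j<b e₀≤ m≤e))
  ... | no  e₀≰ = x≡0⇒x·y≡0 (coeff (P n (suc b ∸ suc j)) e′) (coeffU-> (ρ (suc j)) (ρ-exponents-≤ (suc j)) (ℕP.≰⇒> e₀≰))

  summand-top : ∀ n e₀ e′ → suc n ℕ.+ m ≤ e₀ ℕ.+ deg e′ →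
    summand n e₀ e′ (suc b) ≡ - κ n · coeff ((1ℚ , suc m) ⊙ (x₁⋯xₙ n)) (e₀ ∷ e′)
  summand-top n e₀ e′ m≤e rewrite ℕP.n∸n≡0 b with ℕP.<-cmp e₀ (suc m)
  ... | tri< e₀<m _ _ = trans (y≡0⇒x·y≡0 (coeffU (ρ (suc b)) e₀) (coeff-P-> n 0 e′ n<e′))
                              (sym (y≡0⇒x·y≡0 (- κ n) (coeff-⊙-there 1ℚ (suc m) e₀ (x₁⋯xₙ n) e′ (ℕP.>⇒≢ e₀<m))))
    where
    n<e′ : n < deg e′
    n<e′ = ℕP.+-cancelˡ-≤ m _ _ (ℕP.≤-trans (ℕP.≤-reflexive (ℕP.+-comm m (suc n)))
                                            (ℕP.≤-trans m≤e (ℕP.+-monoˡ-≤ (deg e′) (ℕP.≤-pred e₀<m))))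
  ... | tri≈ _ refl _ = begin
    coeffU (ρ (suc b)) (suc m) · coeff (P n 0) e′              ≡⟨ cong₂ _·_ (ρ-top b) (P₀-top n e′ n≤e′) ⟩
    signedCatalan (suc b) · ((- 1ℚ) ^ℚ n · coeff (x₁⋯xₙ n) e′)
      ≡⟨ lemma (signedCatalan (suc b)) ((- 1ℚ) ^ℚ n) (coeff (x₁⋯xₙ n) e′) ⟩
    - κ n · (1ℚ · coeff (x₁⋯xₙ n) e′)                      ≡⟨ cong (- κ n ·_) (coeff-⊙-here 1ℚ (suc m) (x₁⋯xₙ n) e′) ⟨
    - κ n · coeff ((1ℚ , suc m) ⊙ (x₁⋯xₙ n)) (suc m ∷ e′)  ∎
    where
    n≤e′ : n ≤ deg e′
    n≤e′ = ℕP.+-cancelʳ-≤ m n (deg e′) (ℕP.≤-pred (ℕP.≤-trans m≤e (ℕP.≤-reflexive (cong suc (ℕP.+-comm m (deg e′))))))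
    lemma : ∀ c s o → c · (s · o) ≡ - (- (c · s)) · (1ℚ · o)
    lemma = solve-∀ ℚ-ring
  ... | tri> _ _ m<e₀ = trans (x≡0⇒x·y≡0 (coeff (P n 0) e′) (coeffU-> (ρ (suc b)) (ρ-exponents-≤ (suc b)) m<e₀))
                              (sym (y≡0⇒x·y≡0 (- κ n) (coeff-⊙-there 1ℚ (suc m) e₀ (x₁⋯xₙ n) e′ (ℕP.<⇒≢ m<e₀))))

  summand-bottom : ∀ n e₀ e′ → suc n ℕ.+ m ≤ e₀ ℕ.+ deg e′ →
    (∀ e → n ℕ.+ m ≤ deg e → coeff (P n (suc b)) e ≡ κ n · coeff (basisW₀ n m) e) →
    summand n e₀ e′ 0 ≡ - κ n · coeff ((1ℚ , 1) ⊙ basisW₀ n m) (e₀ ∷ e′)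
  summand-bottom n zero e′ m<e′ _ =
    trans (y≡0⇒x·y≡0 (coeffU (ρ 0) 0) (coeff-P-> n (suc b) e′ m<e′))
          (sym (y≡0⇒x·y≡0 (- κ n) (coeff-⊙-there 1ℚ 1 0 (basisW₀ n m) e′ λ ())))
  summand-bottom n (suc zero) e′ (s≤s m≤e′) P-top-n = begin
    (- 1ℚ + 0ℚ) · coeff (P n (suc b)) e′       ≡⟨ cong ((- 1ℚ + 0ℚ) ·_) (P-top-n e′ m≤e′) ⟩
    (- 1ℚ + 0ℚ) · (κ n · coeff (basisW₀ n m) e′)    ≡⟨ lemma (κ n) (coeff (basisW₀ n m) e′) ⟩
    - κ n · (1ℚ · coeff (basisW₀ n m) e′)           ≡⟨ cong (- κ n ·_) (coeff-⊙-here 1ℚ 1 (basisW₀ n m) e′) ⟨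
    - κ n · coeff ((1ℚ , 1) ⊙ basisW₀ n m) (1 ∷ e′) ∎
    where
    lemma : ∀ k c → (- 1ℚ + 0ℚ) · (k · c) ≡ - k · (1ℚ · c)
    lemma = solve-∀ ℚ-ring
  summand-bottom n (suc (suc e₀)) e′ _ _ =
    trans (ℚP.*-zeroˡ (coeff (P n (suc b)) e′)) (sym (y≡0⇒x·y≡0 (- κ n) (coeff-⊙-there 1ℚ 1 (suc (suc e₀)) (basisW₀ n m) e′ λ ())))

  P-top : ∀ n e → n ℕ.+ m ≤ deg e → coeff (P n (suc b)) e ≡ κ n · coeff (basisW₀ n m) e
  P-top zero    []         m≤0 = contradiction (subst (_≤ 0) (ℕP.+-suc b b) m≤0) λ ()
  P-top (suc n) (e₀ ∷ e′) m≤e = begin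
    coeff (P (suc n) (suc b)) (e₀ ∷ e′)
      ≡⟨ coeff-P-suc n (suc b) e₀ e′ ⟩
    summand n e₀ e′ (suc b) + ∑< (suc b) (summand n e₀ e′)
      ≡⟨ cong (summand n e₀ e′ (suc b) +_) (∑<-truncate (summand n e₀ e′) (s≤s z≤n) (summand-middle n e₀ e′ m≤e)) ⟩
    summand n e₀ e′ (suc b) + (summand n e₀ e′ 0 + 0ℚ)
      ≡⟨ cong₂ (λ x y → x + (y + 0ℚ)) (summand-top n e₀ e′ m≤e) (summand-bottom n e₀ e′ m≤e (P-top n)) ⟩
    - κ n · X + (- κ n · Y + 0ℚ)
      ≡⟨ lemma (signedCatalan (suc b)) ((- 1ℚ) ^ℚ n) X Y ⟩
    κ (suc n) · (X + Y)
      ≡⟨ cong (κ (suc n) ·_) (coeff-basisW₀-suc n m e₀ e′) ⟨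
    κ (suc n) · coeff (basisW₀ (suc n) m) (e₀ ∷ e′) ∎
    where
    X = coeff ((1ℚ , suc m) ⊙ (x₁⋯xₙ n)) (e₀ ∷ e′)
    Y = coeff ((1ℚ , 1) ⊙ basisW₀ n m) (e₀ ∷ e′)
    lemma : ∀ c s X Y → - (- (c · s)) · X + (- (- (c · s)) · Y + 0ℚ) ≡ - (c · (- 1ℚ · s)) · (X + Y)
    lemma = solve-∀ ℚ-ring

  φ-P : ∀ n e → coeff (φ (suc (suc b)) (P n (suc b))) e ≡ κ n · coeff (basisW₀ n m) e
  φ-P n e with deg e ℕ.≟ top n (suc (suc b))
  ... | yes deg≡top = begin
    coeff (φ (suc (suc b)) (P n (suc b))) e   ≡⟨ coeff-filter (λ f → deg f ℕ.≟ top n (suc (suc b))) (P n (suc b)) e deg≡top ⟩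
    coeff (P n (suc b)) e                     ≡⟨ P-top n e (ℕP.≤-reflexive (sym (trans deg≡top (top≡degBound n b)))) ⟩
    κ n · coeff (basisW₀ n m) e               ∎
  ... | no deg≢top = trans (coeff-filter-¬ (λ f → deg f ℕ.≟ top n (suc (suc b))) (P n (suc b)) e deg≢top)
    (sym (y≡0⇒x·y≡0 (κ n) (coeff≡0 (basisW₀ n m) e (basisW₀-homogeneous n m) (deg≢top ∘ flip trans (sym (top≡degBound n b))))))

coeff-combPoly-single : ∀ {n} c m (d : Mono n) e → coeff (combPoly ((c , m , d) ∷ [])) e ≡ c · coeff (basisW m d) e
coeff-combPoly-single c m d e = begin
  coeff (scale c (basisW m d) ++ []) e    ≡⟨ coeff-++ (scale c (basisW m d)) [] e ⟩
  coeff (scale c (basisW m d)) e + 0ℚ     ≡⟨ ℚP.+-identityʳ _ ⟩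
  coeff (scale c (basisW m d)) e          ≡⟨ coeff-scale c (basisW m d) e ⟩
  c · coeff (basisW m d) e                ∎

combCoeff-single : ∀ {n} c m (d : Mono n) → combCoeff ((c , m , d) ∷ []) m d ≡ c
combCoeff-single c m d rewrite dec-true (m ℕ.≟ m) refl | dec-true (VecP.≡-dec ℕ._≟_ d d) refl = ℚP.+-identityʳ c

deg-replicate-0 : ∀ n → deg (replicate n 0) ≡ 0
deg-replicate-0 zero    = refl
deg-replicate-0 (suc n) = deg-replicate-0 n

2[2+b]∸3≡ : ∀ b → 2 * suc (suc b) ∸ 3 ≡ b ℕ.+ suc b
2[2+b]∸3≡ b = cong (_∸ 3) (lemma b)
  where
  lemma : ∀ b → 2 * suc (suc b) ≡ 3 ℕ.+ (b ℕ.+ suc b)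
  lemma = ℕ-solve-∀

proposition2p9 : (k n : ℕ) → 2 ≤ k → 2 * k ∸ 3 ≤ n →
    Σ (Poly n) (λ P → InV k P ×
      Σ (LinComb n) (λ L → WIndexed k L ×
        (∀ e → coeff (φ k P) e ≡ coeff (combPoly L) e) ×
        combCoeff L (2 * k ∸ 3) (replicate n 0) ≢ 0ℚ))
proposition2p9 1 n (s≤s ()) _
proposition2p9 k@(suc (suc b)) n _ _ =
  P n (suc b) , (P-reduced n b , P-zeroOfMult n (suc b)) , L , (indexed , tt) , φP≡L ,
  κ≢0 n ∘ trans (sym (combCoeff-single (κ n) (2 * k ∸ 3) (replicate n 0)))
  where
  open TopDegree b using (m; κ; κ≢0; φ-P)
  L : LinComb n
  L = (κ n , 2 * k ∸ 3 , replicate n 0) ∷ []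
  indexed : 2 * k ∸ 3 ℕ.+ 2 * deg (replicate n 0) ≡ 2 * k ∸ 3
  indexed = trans (cong (λ d → 2 * k ∸ 3 ℕ.+ 2 * d) (deg-replicate-0 n)) (ℕP.+-identityʳ _)
  φP≡L : ∀ e → coeff (φ k (P n (suc b))) e ≡ coeff (combPoly L) e
  φP≡L e = begin
    coeff (φ k (P n (suc b))) e              ≡⟨ φ-P n e ⟩
    κ n · coeff (basisW₀ n m) e              ≡⟨ cong (λ m′ → κ n · coeff (basisW₀ n m′) e) (2[2+b]∸3≡ b) ⟨
    κ n · coeff (basisW₀ n (2 * k ∸ 3)) e    ≡⟨ coeff-combPoly-single (κ n) (2 * k ∸ 3) (replicate n 0) e ⟨
    coeff (combPoly L) e                     ∎
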